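{- Let $X=\mathcal{M}_O(n,a,b)$ be feasible with $a>1$, and suppose $[v_0,v_a]\in\mathcal{B}$. Then $X$ admits an automorphism of order $2$ that maps $\mathcal{B}$ onto $\mathcal{R}$ and $\mathcal{R}$ onto $\mathcal{B}$ if and only if $8\mid n$, $b=4b_0+3<(3n+4)/4$ with $b_0>0$ even, $4(b_0+1)^2\equiv 4\pmod n$, and $a=b-n/2-2$.
   Context: For even $n\ge4$ and odd $0<a<b<n$, $\mathcal{M}_O(n,a,b)$ has vertices $u_0,\dots,u_{n-1},v_0,\dots,v_{n-1}$ and edges $[u_i,u_{i+1}]$, $[u_i,v_i]$ for all $i$ and $[v_i,v_{i+a}]$, $[v_i,v_{i+b}]$ for even $i$ (subscripts mod $n$). It is feasible if $\gcd(b-a,n)=2$, $(b-a)^2/2\equiv 2\pmod n$, at least one of $a+(a-1)(a-b)/2\equiv1$ or $b+(b-1)(b-a)/2\equiv 1\pmod n$ holds, and $1\le a<b-2<n-a-2$. Let $x=a$ if $a+(a-1)(a-b)/2\equiv 1\pmod n$ and $x=b$ otherwise, and $y$ the other element of $\{a,b\}$. $\mathcal{R}=\{[u_i,v_i]\}$; $\mathcal{B}=\{[u_i,u_{i+1}]: i\text{ even}\}\cup\{[v_j,v_{j+x}]: j\text{ even}\}$; $\mathcal{G}=\{[u_i,u_{i+1}]: i\text{ odd}\}\cup\{[v_j,v_{j+y}]: j\text{ even}\}$. -}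

module Defs where

open import Data.Nat as ℕ using (ℕ; NonZero; _+_; _*_; _∸_; _^_; _<_; _≤_)
open import Data.Nat.DivMod using (_mod_; _/_)
open import Data.Nat.GCD using (gcd)
open import Data.Nat.Divisibility as ND using ()
open import Data.Integer as ℤ using (ℤ; +_)
open import Data.Integer.Divisibility as ZD using ()
open import Data.Fin using (Fin; toℕ)
open import Data.Product using (_×_; Σ; ∃; ∃-syntax; _,_)
open import Data.Sum using (_⊎_)
open import Relation.Nullary using (¬_)
open import Relation.Binary.PropositionalEquality using (_≡_; _≢_)
open import Function.Definitions using (Bijective)

_≡_[mod_] : ℤ → ℤ → ℕ → Set
x ≡ y [mod n ] = (+ n) ZD.∣ (x ℤ.- y)

data Vtx (n : ℕ) : Set where
  u v : Fin n → Vtx n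

_⊕_ : ∀ {n} .{{_ : NonZero n}} → Fin n → ℕ → Fin n
_⊕_ {n} i k = (toℕ i + k) mod n

Rel : ℕ → Set₁
Rel n = Vtx n → Vtx n → Set

-- symmetric closure: an edge [x,y] is an unordered pair
Sym : ∀ {n} → Rel n → Rel n
Sym E x y = E x y ⊎ E y x

_∪_ : ∀ {n} → Rel n → Rel n → Rel n
(E ∪ F) x y = E x y ⊎ F x y

module _ (n : ℕ) .{{_ : NonZero n}} where

  spokeD : Rel n
  spokeD x y = ∃[ i ] (x ≡ u i × y ≡ v i)

  rimEvenD : Rel n
  rimEvenD x y = ∃[ i ] (2 ND.∣ toℕ i × x ≡ u i × y ≡ u (i ⊕ 1))

  rimOddD : Rel n
  rimOddD x y = ∃[ i ] (¬ (2 ND.∣ toℕ i) × x ≡ u i × y ≡ u (i ⊕ 1))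

  innerD : ℕ → Rel n
  innerD s x y = ∃[ i ] (2 ND.∣ toℕ i × x ≡ v i × y ≡ v (i ⊕ s))

  Edge : ℕ → ℕ → Rel n
  Edge a b = Sym (spokeD ∪ (rimEvenD ∪ (rimOddD ∪ (innerD a ∪ innerD b))))

-- a + (a-1)(a-b)/2 ≡ 1 (mod n)   (a odd, so (a-1)/2 is exact)
CondA : ℕ → ℕ → ℕ → Set
CondA n a b = ((+ a) ℤ.+ (+ ((a ∸ 1) / 2)) ℤ.* ((+ a) ℤ.- (+ b))) ≡ (+ 1) [mod n ]

CondB : ℕ → ℕ → ℕ → Set
CondB n a b = ((+ b) ℤ.+ (+ ((b ∸ 1) / 2)) ℤ.* ((+ b) ℤ.- (+ a))) ≡ (+ 1) [mod n ]

Feasible : ℕ → ℕ → ℕ → Set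
Feasible n a b =
    2 ND.∣ n × 4 ≤ n × ¬ (2 ND.∣ a) × ¬ (2 ND.∣ b) × 0 < a × a < b × b < n
  × gcd (b ∸ a) n ≡ 2
  × ((+ ((b ∸ a) * ((b ∸ a) / 2))) ≡ (+ 2) [mod n ])
  × (CondA n a b ⊎ CondB n a b)
  × 1 ≤ a × a < b ∸ 2 × (+ b) ℤ.- (+ 2) ℤ.< (+ n) ℤ.- (+ a) ℤ.- (+ 2)

module _ (n a b : ℕ) .{{_ : NonZero n}} where

  -- colour classes; x = a if CondA holds, x = b otherwise, y the other one
  R : Rel n
  R = Sym (spokeD n)

  B : Rel n
  B x y = Sym (rimEvenD n) x y
        ⊎ (CondA n a b × Sym (innerD n a) x y)
        ⊎ (¬ CondA n a b × Sym (innerD n b) x y)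

  G : Rel n
  G x y = Sym (rimOddD n) x y
        ⊎ (CondA n a b × Sym (innerD n b) x y)
        ⊎ (¬ CondA n a b × Sym (innerD n a) x y)

IsAutomorphism : ∀ {n} → Rel n → (Vtx n → Vtx n) → Set
IsAutomorphism E σ = Bijective _≡_ _≡_ σ
  × (∀ x y → (E x y → E (σ x) (σ y)) × (E (σ x) (σ y) → E x y))

HasOrder2 : ∀ {n} → (Vtx n → Vtx n) → Set
HasOrder2 σ = (∀ x → σ (σ x) ≡ x) × ∃[ x ] (σ x ≢ x)

MapsOnto : ∀ {n} → (Vtx n → Vtx n) → Rel n → Rel n → Set
MapsOnto σ P Q = (∀ x y → P x y → Q (σ x) (σ y))
  × (∀ x y → Q x y → ∃[ x' ] ∃[ y' ] (P x' y' × σ x' ≡ x × σ y' ≡ y))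

{-# OPTIONS --safe #-}
-- Colour the spokes red, B blue and G green.  Each colour class is a perfect matching, so an
-- involutive automorphism exchanging B and R is the same as an involution σ with
-- σ ∘ red = blue ∘ σ, σ ∘ blue = red ∘ σ and σ ∘ green = green ∘ σ.
-- Necessity: σ conjugates the walk green-blue-green-blue, which moves u_{2k} to u_{2k-4}, into
-- green-red-green-red, which moves u_{2k} to u_{2k-b-1} and v_{2k} to v_{2k+b+1}.  Following the
-- orbit of u_0 (composing σ with i ↦ -1-i if σ(u_0) has odd index) gives 4 ∣ n, a ≡ 1 and
-- b ≡ 3 (mod 4) and two further congruences; with the feasibility congruences these give
-- n ∣ 2(b-a-2), and since 0 < 2(b-a-2) < 2n, n = 2(b-a-2), from which the conditions follow.
-- Sufficiency: writing n = 8s, a = 4A+1 and b = 4M-1, an explicit formula on indices modulo 4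
-- (σᴸ below) commutes with the colours as required as soon as M² ≡ 1, A(M+1) ≡ 0 and
-- 2(M-1-A) ≡ 0 (mod 2s).
module Submission where

open import Defs
open import Data.Nat as ℕ using (ℕ; NonZero; zero; suc)
import Data.Nat.Properties as ℕ
import Data.Nat.DivMod as ℕ
import Data.Nat.Divisibility as ND
open import Data.Integer as ℤ using (ℤ; +_)
import Data.Integer.Properties as ℤ
open import Data.Fin as Fin using (Fin; toℕ; fromℕ<)
import Data.Fin.Properties as Fin
open import Data.Fin.Patterns using (0F; 1F; 2F; 3F)
open import Data.List using (List; []; _∷_; map)
open import Data.Product using (∃-syntax; _×_; _,_; proj₁; proj₂)
open import Data.Sum using (_⊎_; inj₁; inj₂; [_,_]′)
open import Data.Empty using (⊥-elim)
open import Relation.Nullary using (¬_; yes; no; contradiction)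
open import Relation.Binary.PropositionalEquality
open import Function using (_∘_)
open import Function.Definitions using (Injective)


u-injective : ∀ {n} {i j : Fin n} → Vtx.u i ≡ u j → i ≡ j
u-injective refl = refl

v-injective : ∀ {n} {i j : Fin n} → Vtx.v i ≡ v j → i ≡ j
v-injective refl = refl

toℕ-mod : ∀ {m n} .{{_ : NonZero n}} → m ℕ.< n → toℕ (m ℕ.mod n) ≡ m
toℕ-mod m<n = trans (Fin.toℕ-fromℕ< _) (ℕ.m<n⇒m%n≡m m<n)

module Congruence where
  open import Data.Integer using (_+_; _*_; _-_; -_; ∣_∣; _⊖_)
  open import Data.Integer.Divisibility.Signed
  open import Data.Integer.Tactic.RingSolver
  import Data.Nat.Divisibility as ℕ

  multiple-of-larger≡0 : ∀ {d z} → + d ∣ z → ∣ z ∣ ℕ.< d → z ≡ + 0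
  multiple-of-larger≡0 {d} {z} d∣z ∣z∣<d with ∣ z ∣ ℕ.≟ 0
  ... | yes ∣z∣≡0 = ℤ.∣i∣≡0⇒i≡0 ∣z∣≡0
  ... | no ∣z∣≢0 = contradiction (∣⇒∣ᵤ d∣z) (ℕ.>⇒∤ {{ℕ.≢-nonZero ∣z∣≢0}} ∣z∣<d)

  ∣m-n∣<d : ∀ {d m n} → m ℕ.< d → n ℕ.< d → ∣ + m - + n ∣ ℕ.< d
  ∣m-n∣<d {d} {m} {n} m<d n<d = begin-strict
      ∣ + m - + n ∣  ≡⟨ cong ∣_∣ (ℤ.m-n≡m⊖n m n) ⟩
      ∣ m ⊖ n ∣      ≤⟨ ℤ.∣m⊝n∣≤m⊔n m n ⟩
      m ℕ.⊔ n        <⟨ ℕ.⊔-lub m<d n<d ⟩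
      d              ∎
    where open ℕ.≤-Reasoning

  ∣m-n∣⇒m≡n : ∀ {d m n} → m ℕ.< d → n ℕ.< d → + d ∣ + m - + n → m ≡ n
  ∣m-n∣⇒m≡n m<d n<d d∣m-n = ℤ.+-injective (ℤ.i-j≡0⇒i≡j _ _ (multiple-of-larger≡0 d∣m-n (∣m-n∣<d m<d n<d)))

  Fin-∣-injective : ∀ {d} {i j : Fin d} → + d ∣ + toℕ i - + toℕ j → i ≡ j
  Fin-∣-injective {d} {i} {j} d∣i-j =
    Fin.toℕ-injective (∣m-n∣⇒m≡n (Fin.toℕ<n i) (Fin.toℕ<n j) d∣i-j)

  ∣-resp : ∀ {k x y} → k ∣ y → x ≡ y → k ∣ x
  ∣-resp k∣y refl = k∣y

  ∣-refl-difference : ∀ {k} x → k ∣ x - x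
  ∣-refl-difference x = ∣-resp (divides (+ 0) refl) (ℤ.+-inverseʳ x)

  -- Unlike x ≡ y [mod k ], this record determines x and y, so they can be left implicit.
  infix 4 _≡_⟨mod_⟩
  record _≡_⟨mod_⟩ (x y : ℤ) (k : ℕ) : Set where
    constructor mod⟨_⟩
    field ∣-difference : + k ∣ x - y
  open _≡_⟨mod_⟩ public

  [mod]⇒⟨mod⟩ : ∀ {k} x y → x ≡ y [mod k ] → x ≡ y ⟨mod k ⟩
  [mod]⇒⟨mod⟩ _ _ x≡y = mod⟨ ∣ᵤ⇒∣ x≡y ⟩

  ⟨mod⟩⇒[mod] : ∀ {k x y} → x ≡ y ⟨mod k ⟩ → x ≡ y [mod k ]
  ⟨mod⟩⇒[mod] x≡y = ∣⇒∣ᵤ (∣-difference x≡y)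

  ≡⇒≡⟨mod⟩ : ∀ {k x y} → x ≡ y → x ≡ y ⟨mod k ⟩
  ≡⇒≡⟨mod⟩ {x = x} refl = mod⟨ ∣-refl-difference x ⟩

  mod-refl : ∀ {k x} → x ≡ x ⟨mod k ⟩
  mod-refl = ≡⇒≡⟨mod⟩ refl

  mod-sym : ∀ {k x y} → x ≡ y ⟨mod k ⟩ → y ≡ x ⟨mod k ⟩
  mod-sym {x = x} {y} mod⟨ k∣x-y ⟩ = mod⟨ ∣-resp (∣m⇒∣-m k∣x-y) (solve (x ∷ y ∷ [])) ⟩

  mod-trans : ∀ {k x y z} → x ≡ y ⟨mod k ⟩ → y ≡ z ⟨mod k ⟩ → x ≡ z ⟨mod k ⟩
  mod-trans {x = x} {y} {z} mod⟨ k∣x-y ⟩ mod⟨ k∣y-z ⟩ =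
    mod⟨ ∣-resp (∣m∣n⇒∣m+n k∣x-y k∣y-z) (solve (x ∷ y ∷ z ∷ [])) ⟩

  mod-by-difference : ∀ {k x y x′ y′} → x ≡ y ⟨mod k ⟩ → x - y ≡ x′ - y′ → x′ ≡ y′ ⟨mod k ⟩
  mod-by-difference mod⟨ k∣x-y ⟩ eq = mod⟨ subst (_ ∣_) eq k∣x-y ⟩

  to-zero-mod : ∀ {k x y} → x ≡ y ⟨mod k ⟩ → x - y ≡ + 0 ⟨mod k ⟩
  to-zero-mod {x = x} {y} x≡y = mod-by-difference x≡y (solve (x ∷ y ∷ []))

  zero-mod⇒∣ : ∀ {k x} → x ≡ + 0 ⟨mod k ⟩ → + k ∣ x
  zero-mod⇒∣ {x = x} mod⟨ k∣x-0 ⟩ = ∣-resp k∣x-0 (sym (ℤ.+-identityʳ x))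

  ∣⇒zero-mod : ∀ {k x} → + k ∣ x → x ≡ + 0 ⟨mod k ⟩
  ∣⇒zero-mod {x = x} k∣x = mod⟨ ∣-resp k∣x (ℤ.+-identityʳ x) ⟩

  linear-combination₂ : ∀ {k x₁ x₂} c₁ c₂ → x₁ ≡ + 0 ⟨mod k ⟩ → x₂ ≡ + 0 ⟨mod k ⟩ →
                        c₁ * x₁ + c₂ * x₂ ≡ + 0 ⟨mod k ⟩
  linear-combination₂ c₁ c₂ x₁≡0 x₂≡0 = ∣⇒zero-mod
    (∣m∣n⇒∣m+n (∣n⇒∣m*n c₁ (zero-mod⇒∣ x₁≡0)) (∣n⇒∣m*n c₂ (zero-mod⇒∣ x₂≡0)))

  linear-combination : ∀ {k x₁ x₂ x₃ x₄} c₁ c₂ c₃ c₄ →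
                       x₁ ≡ + 0 ⟨mod k ⟩ → x₂ ≡ + 0 ⟨mod k ⟩ → x₃ ≡ + 0 ⟨mod k ⟩ → x₄ ≡ + 0 ⟨mod k ⟩ →
                       c₁ * x₁ + c₂ * x₂ + c₃ * x₃ + c₄ * x₄ ≡ + 0 ⟨mod k ⟩
  linear-combination c₁ c₂ c₃ c₄ x₁≡0 x₂≡0 x₃≡0 x₄≡0 = ∣⇒zero-mod
    (∣m∣n⇒∣m+n (∣m∣n⇒∣m+n (∣m∣n⇒∣m+n (∣n⇒∣m*n c₁ (zero-mod⇒∣ x₁≡0)) (∣n⇒∣m*n c₂ (zero-mod⇒∣ x₂≡0)))
                          (∣n⇒∣m*n c₃ (zero-mod⇒∣ x₃≡0)))
               (∣n⇒∣m*n c₄ (zero-mod⇒∣ x₄≡0)))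

  *-cancelˡ-mod : ∀ {k x y} d .{{_ : NonZero d}} → + d * x ≡ + d * y ⟨mod d ℕ.* k ⟩ → x ≡ y ⟨mod k ⟩
  *-cancelˡ-mod {k} {x} {y} d mod⟨ divides q eq ⟩ = mod⟨ divides q (ℤ.*-cancelˡ-≡ (+ d) _ _ (begin
      + d * (x - y)        ≡⟨ distrib (+ d) x y ⟩
      + d * x - + d * y    ≡⟨ eq ⟩
      q * + (d ℕ.* k)      ≡⟨ cong (q *_) (ℤ.pos-* d k) ⟩
      q * (+ d * + k)      ≡⟨ reorder q (+ d) (+ k) ⟩
      + d * (q * + k)      ∎)) ⟩
    where
    open ≡-Reasoning
    distrib : ∀ d x y → d * (x - y) ≡ d * x - d * y
    distrib = solve-∀
    reorder : ∀ q d k → q * (d * k) ≡ d * (q * k)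
    reorder = solve-∀

  *-congˡ-mod : ∀ {k x y} d → x ≡ y ⟨mod k ⟩ → + d * x ≡ + d * y ⟨mod d ℕ.* k ⟩
  *-congˡ-mod {k} {x} {y} d mod⟨ divides q eq ⟩ = mod⟨ divides q (begin
      + d * x - + d * y    ≡⟨ distrib (+ d) x y ⟩
      + d * (x - y)        ≡⟨ cong (+ d *_) eq ⟩
      + d * (q * + k)      ≡⟨ reorder (+ d) q (+ k) ⟩
      q * (+ d * + k)      ≡⟨ cong (q *_) (ℤ.pos-* d k) ⟨
      q * + (d ℕ.* k)      ∎) ⟩
    where
    open ≡-Reasoning
    distrib : ∀ d x y → d * x - d * y ≡ d * (x - y)
    distrib = solve-∀
    reorder : ∀ d q k → d * (q * k) ≡ q * (d * k)
    reorder = solve-∀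

  pos-even : ∀ {m} q → m ≡ 2 ℕ.* q → + m ≡ + 2 * + q
  pos-even q refl = ℤ.pos-* 2 q

  pos-odd : ∀ {m} q → m ≡ 1 ℕ.+ 2 ℕ.* q → + m ≡ + 1 + + 2 * + q
  pos-odd q refl = cong (_+_ (+ 1)) (ℤ.pos-* 2 q)

  +-congʳ-mod : ∀ {k x y} c → x ≡ y ⟨mod k ⟩ → x + c ≡ y + c ⟨mod k ⟩
  +-congʳ-mod {x = x} {y} c mod⟨ k∣x-y ⟩ = mod⟨ ∣-resp k∣x-y (solve (x ∷ y ∷ c ∷ [])) ⟩

  *-congʳ-mod : ∀ {k x y} c → x ≡ y ⟨mod k ⟩ → x * c ≡ y * c ⟨mod k ⟩
  *-congʳ-mod {x = x} {y} c mod⟨ k∣x-y ⟩ = mod⟨ ∣-resp (∣m⇒∣m*n c k∣x-y) (solve (x ∷ y ∷ c ∷ [])) ⟩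

  neg-cong-mod : ∀ {k x y} → x ≡ y ⟨mod k ⟩ → - x ≡ - y ⟨mod k ⟩
  neg-cong-mod {x = x} {y} mod⟨ k∣x-y ⟩ = mod⟨ ∣-resp (∣m⇒∣-m k∣x-y) (solve (x ∷ y ∷ [])) ⟩

module Residues (n : ℕ) .{{_ : NonZero n}} where
  open import Data.Integer using (_+_; _*_; _-_; -_)
  open import Data.Integer.DivMod using (n%ℕd<d; a≡a%ℕn+[a/ℕn]*n; _%ℕ_; _/ℕ_)
  open import Data.Integer.Divisibility.Signed using (divides)
  open import Data.Integer.Tactic.RingSolver
  open Congruence

  residue : ℤ → Fin n
  residue z = fromℕ< (n%ℕd<d z n)

  residue-toℕ : ∀ j → residue (+ toℕ j) ≡ j
  residue-toℕ j = Fin.toℕ-injective (trans (Fin.toℕ-fromℕ< _) (ℕ.m<n⇒m%n≡m (Fin.toℕ<n j)))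

  residue-mod : ∀ z → z ≡ + toℕ (residue z) ⟨mod n ⟩
  residue-mod z = mod⟨ divides (z /ℕ n) (begin
      z - + toℕ (residue z)     ≡⟨ cong (λ r → z - + r) (Fin.toℕ-fromℕ< _) ⟩
      z - + r                   ≡⟨ cong (_- + r) (a≡a%ℕn+[a/ℕn]*n z n) ⟩
      + r + z /ℕ n * + n - + r  ≡⟨ cancel (+ r) (z /ℕ n * + n) ⟩
      z /ℕ n * + n              ∎) ⟩
    where
    open ≡-Reasoning
    r : ℕ
    r = z %ℕ n
    cancel : ∀ r s → r + s - r ≡ s
    cancel = solve-∀

  residue-cong : ∀ {x y} → x ≡ y ⟨mod n ⟩ → residue x ≡ residue y
  residue-cong {x} {y} x≡y = Fin-∣-injective (∣-difference
    (mod-trans (mod-sym (residue-mod x)) (mod-trans x≡y (residue-mod y))))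

  residue-injective : ∀ {x y} → residue x ≡ residue y → x ≡ y ⟨mod n ⟩
  residue-injective {x} {y} rx≡ry = mod-trans (residue-mod x)
    (subst (λ r → + toℕ r ≡ y ⟨mod n ⟩) (sym rx≡ry) (mod-sym (residue-mod y)))

module Lifting (n d m : ℕ) .{{_ : NonZero n}} .{{_ : NonZero d}} (n≡d*m : n ≡ d ℕ.* m) where
  open import Data.Integer using (_+_; _*_; _-_; -_)
  import Data.Integer.Divisibility as Unsigned
  open import Data.Integer.Divisibility.Signed
  open import Data.Integer.Tactic.RingSolver
  open Congruence
  open Residues n

  -- The label s K r names the vertex s_{dK+r}; K only matters modulo m = n / d.
  data Label : Set where
    u v : ℤ → Fin d → Label

  index : ℤ → Fin d → ℤ
  index K r = + d * K + + toℕ r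

  π : Label → Vtx n
  π (u K r) = u (residue (index K r))
  π (v K r) = v (residue (index K r))

  lift : Vtx n → Label
  lift (u j) = u (+ (toℕ j ℕ./ d)) (toℕ j ℕ.mod d)
  lift (v j) = v (+ (toℕ j ℕ./ d)) (toℕ j ℕ.mod d)

  index-lift : ∀ (j : Fin n) → index (+ (toℕ j ℕ./ d)) (toℕ j ℕ.mod d) ≡ + toℕ j
  index-lift j = begin
      + d * + q + + toℕ (t ℕ.mod d)  ≡⟨ cong (λ r → + d * + q + + r) (Fin.toℕ-fromℕ< _) ⟩
      + d * + q + + r                ≡⟨ reorder (+ d) (+ q) (+ r) ⟩
      + r + + q * + d                ≡⟨ cong (_+_ (+ r)) (ℤ.pos-* q d) ⟨
      + r + + (q ℕ.* d)              ≡⟨ ℤ.pos-+ r (q ℕ.* d) ⟨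
      + (r ℕ.+ q ℕ.* d)              ≡⟨ cong +_ (ℕ.m≡m%n+[m/n]*n t d) ⟨
      + t                            ∎
    where
    open ≡-Reasoning
    t q r : ℕ
    t = toℕ j
    q = t ℕ./ d
    r = t ℕ.% d
    reorder : ∀ d q r → d * q + r ≡ r + q * d
    reorder = solve-∀

  π-lift : ∀ x → π (lift x) ≡ x
  π-lift (u j) = cong u (trans (cong residue (index-lift j)) (residue-toℕ j))
  π-lift (v j) = cong v (trans (cong residue (index-lift j)) (residue-toℕ j))

  infix 4 _≈_
  data _≈_ : Label → Label → Set where
    u≈ : ∀ {K K′ r} → K ≡ K′ ⟨mod m ⟩ → u K r ≈ u K′ r
    v≈ : ∀ {K K′ r} → K ≡ K′ ⟨mod m ⟩ → v K r ≈ v K′ r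

  u≉v : ∀ {K K′ r r′} → ¬ (u K r ≈ v K′ r′)
  u≉v ()

  v≉u : ∀ {K K′ r r′} → ¬ (v K r ≈ u K′ r′)
  v≉u ()

  u≈⁻¹ : ∀ {K K′ r r′} → u K r ≈ u K′ r′ → K ≡ K′ ⟨mod m ⟩
  u≈⁻¹ (u≈ K≡K′) = K≡K′

  v≈⁻¹ : ∀ {K K′ r r′} → v K r ≈ v K′ r′ → K ≡ K′ ⟨mod m ⟩
  v≈⁻¹ (v≈ K≡K′) = K≡K′

  bit : Label → Fin d
  bit (u _ r) = r
  bit (v _ r) = r

  ≈-bit : ∀ {ℓ ℓ′} → ℓ ≈ ℓ′ → bit ℓ ≡ bit ℓ′
  ≈-bit (u≈ _) = refl
  ≈-bit (v≈ _) = refl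

  private
    n≡d*m-ℤ : + n ≡ + d * + m
    n≡d*m-ℤ = trans (cong +_ n≡d*m) (ℤ.pos-* d m)

  index-cong : ∀ {K K′ r} → K ≡ K′ ⟨mod m ⟩ → index K r ≡ index K′ r ⟨mod n ⟩
  index-cong {K} {K′} {r} mod⟨ divides q K-K′≡q*m ⟩ = mod⟨ divides q (begin
      (+ d * K + + toℕ r) - (+ d * K′ + + toℕ r)  ≡⟨ factor (+ d) K K′ (+ toℕ r) ⟩
      + d * (K - K′)                             ≡⟨ cong (+ d *_) K-K′≡q*m ⟩
      + d * (q * + m)                            ≡⟨ reorder (+ d) q (+ m) ⟩
      q * (+ d * + m)                            ≡⟨ cong (q *_) n≡d*m-ℤ ⟨
      q * + n                                    ∎) ⟩
    where
    open ≡-Reasoning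
    factor : ∀ d K K′ r → (d * K + r) - (d * K′ + r) ≡ d * (K - K′)
    factor = solve-∀
    reorder : ∀ d q m → d * (q * m) ≡ q * (d * m)
    reorder = solve-∀

  index-injective : ∀ {K K′ r r′} → index K r ≡ index K′ r′ ⟨mod n ⟩ → r ≡ r′ × (K ≡ K′ ⟨mod m ⟩)
  index-injective {K} {K′} {r} {r′} mod⟨ n∣Δ ⟩ = r≡r′ , mod⟨ m∣K-K′ ⟩
    where
    d∣n : + d ∣ + n
    d∣n = divides (+ m) (trans n≡d*m-ℤ (ℤ.*-comm (+ d) (+ m)))
    split : ∀ d K K′ r r′ → (d * K + r) - (d * K′ + r′) ≡ d * (K - K′) + (r - r′)
    split = solve-∀
    d∣r-r′ : + d ∣ + toℕ r - + toℕ r′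
    d∣r-r′ = ∣m+n∣m⇒∣n (∣-resp (∣-trans d∣n n∣Δ) (sym (split (+ d) K K′ (+ toℕ r) (+ toℕ r′))))
                        (∣m⇒∣m*n (K - K′) (∣-refl {+ d}))
    r≡r′ : r ≡ r′
    r≡r′ = Fin-∣-injective d∣r-r′
    n∣d[K-K′] : + d * + m ∣ + d * (K - K′)
    n∣d[K-K′] = subst (_∣ _) n≡d*m-ℤ (∣-resp n∣Δ (begin
        + d * (K - K′)                               ≡⟨ drop (+ d) K K′ (+ toℕ r) ⟩
        (+ d * K + + toℕ r) - (+ d * K′ + + toℕ r)   ≡⟨ cong (λ s → (+ d * K + + toℕ r) - (+ d * K′ + + toℕ s)) r≡r′ ⟩
        (+ d * K + + toℕ r) - (+ d * K′ + + toℕ r′)  ∎))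
      where
      open ≡-Reasoning
      drop : ∀ d K K′ r → d * (K - K′) ≡ (d * K + r) - (d * K′ + r)
      drop = solve-∀
    m∣K-K′ : + m ∣ K - K′
    m∣K-K′ = ∣ᵤ⇒∣ (Unsigned.*-cancelˡ-∣ (+ d) (∣⇒∣ᵤ n∣d[K-K′]))

  π-cong : ∀ {ℓ ℓ′} → ℓ ≈ ℓ′ → π ℓ ≡ π ℓ′
  π-cong (u≈ K≡K′) = cong u (residue-cong (index-cong K≡K′))
  π-cong (v≈ K≡K′) = cong v (residue-cong (index-cong K≡K′))

  private
    u≈-from-index : ∀ {K K′ r r′} → r ≡ r′ × (K ≡ K′ ⟨mod m ⟩) → u K r ≈ u K′ r′
    u≈-from-index (refl , K≡K′) = u≈ K≡K′

    v≈-from-index : ∀ {K K′ r r′} → r ≡ r′ × (K ≡ K′ ⟨mod m ⟩) → v K r ≈ v K′ r′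
    v≈-from-index (refl , K≡K′) = v≈ K≡K′

  π-injective : ∀ {ℓ ℓ′} → π ℓ ≡ π ℓ′ → ℓ ≈ ℓ′
  π-injective {u _ _} {u _ _} eq = u≈-from-index (index-injective (residue-injective (u-injective eq)))
  π-injective {v _ _} {v _ _} eq = v≈-from-index (index-injective (residue-injective (v-injective eq)))
  π-injective {u _ _} {v _ _} ()
  π-injective {v _ _} {u _ _} ()

  lift-π : ∀ ℓ → lift (π ℓ) ≈ ℓ
  lift-π ℓ = π-injective (π-lift (π ℓ))

  Congruent : (Label → Label) → Set
  Congruent f = ∀ {ℓ ℓ′} → ℓ ≈ ℓ′ → f ℓ ≈ f ℓ′

  descend : (Label → Label) → Vtx n → Vtx n
  descend f x = π (f (lift x))

  descend-π : ∀ {f} → Congruent f → ∀ ℓ → descend f (π ℓ) ≡ π (f ℓ)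
  descend-π f-cong ℓ = π-cong (f-cong (lift-π ℓ))

  descend-comm : ∀ {f g} → Congruent f → Congruent g → (∀ ℓ → f (g ℓ) ≈ g (f ℓ)) →
                 ∀ x → descend f (descend g x) ≡ descend g (descend f x)
  descend-comm {f} {g} f-cong g-cong fg≈gf x = begin
    descend f (π (g (lift x)))  ≡⟨ descend-π f-cong _ ⟩
    π (f (g (lift x)))          ≡⟨ π-cong (fg≈gf (lift x)) ⟩
    π (g (f (lift x)))          ≡⟨ descend-π g-cong _ ⟨
    descend g (π (f (lift x)))  ∎
    where open ≡-Reasoning

open Congruence using (_≡_⟨mod_⟩)

data Colour : Set where
  red blue green : Colour

swap : Colour → Colour
swap red   = blue
swap blue  = red
swap green = green

module ColourMaps (n h : ℕ) .{{_ : NonZero n}} (n≡2h : n ≡ 2 ℕ.* h) (α β : ℤ) where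
  open import Data.Integer using (_+_; _*_; _-_; -_)
  open import Data.Integer.Tactic.RingSolver
  open Congruence
  open Lifting n 2 h n≡2h public

  -- With a = 1+2α and b = 1+2β: blue joins u_{2K}, u_{2K+1} and v_{2K}, v_{2K+a};
  -- green joins u_{2K+1}, u_{2K+2} and v_{2K}, v_{2K+b}.
  neighbourᴸ : Colour → Label → Label
  neighbourᴸ red   (u K r)  = v K r
  neighbourᴸ red   (v K r)  = u K r
  neighbourᴸ blue  (u K 0F) = u K 1F
  neighbourᴸ blue  (u K 1F) = u K 0F
  neighbourᴸ blue  (v K 0F) = v (K + α) 1F
  neighbourᴸ blue  (v K 1F) = v (K - α) 0F
  neighbourᴸ green (u K 0F) = u (K - + 1) 1F
  neighbourᴸ green (u K 1F) = u (K + + 1) 0F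
  neighbourᴸ green (v K 0F) = v (K + β) 1F
  neighbourᴸ green (v K 1F) = v (K - β) 0F

  neighbourᴸ-cong : ∀ c → Congruent (neighbourᴸ c)
  neighbourᴸ-cong red   (u≈ K≡K′)          = v≈ K≡K′
  neighbourᴸ-cong red   (v≈ K≡K′)          = u≈ K≡K′
  neighbourᴸ-cong blue  (u≈ {r = 0F} K≡K′) = u≈ K≡K′
  neighbourᴸ-cong blue  (u≈ {r = 1F} K≡K′) = u≈ K≡K′
  neighbourᴸ-cong blue  (v≈ {r = 0F} K≡K′) = v≈ (+-congʳ-mod α K≡K′)
  neighbourᴸ-cong blue  (v≈ {r = 1F} K≡K′) = v≈ (+-congʳ-mod (- α) K≡K′)
  neighbourᴸ-cong green (u≈ {r = 0F} K≡K′) = u≈ (+-congʳ-mod (- + 1) K≡K′)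
  neighbourᴸ-cong green (u≈ {r = 1F} K≡K′) = u≈ (+-congʳ-mod (+ 1) K≡K′)
  neighbourᴸ-cong green (v≈ {r = 0F} K≡K′) = v≈ (+-congʳ-mod β K≡K′)
  neighbourᴸ-cong green (v≈ {r = 1F} K≡K′) = v≈ (+-congʳ-mod (- β) K≡K′)

  neighbourᴸ-involutive : ∀ c ℓ → neighbourᴸ c (neighbourᴸ c ℓ) ≈ ℓ
  neighbourᴸ-involutive red   (u K r)  = u≈ mod-refl
  neighbourᴸ-involutive red   (v K r)  = v≈ mod-refl
  neighbourᴸ-involutive blue  (u K 0F) = u≈ mod-refl
  neighbourᴸ-involutive blue  (u K 1F) = u≈ mod-refl
  neighbourᴸ-involutive blue  (v K 0F) = v≈ (≡⇒≡⟨mod⟩ (solve (K ∷ α ∷ [])))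
  neighbourᴸ-involutive blue  (v K 1F) = v≈ (≡⇒≡⟨mod⟩ (solve (K ∷ α ∷ [])))
  neighbourᴸ-involutive green (u K 0F) = u≈ (≡⇒≡⟨mod⟩ (solve (K ∷ [])))
  neighbourᴸ-involutive green (u K 1F) = u≈ (≡⇒≡⟨mod⟩ (solve (K ∷ [])))
  neighbourᴸ-involutive green (v K 0F) = v≈ (≡⇒≡⟨mod⟩ (solve (K ∷ β ∷ [])))
  neighbourᴸ-involutive green (v K 1F) = v≈ (≡⇒≡⟨mod⟩ (solve (K ∷ β ∷ [])))

  neighbour : Colour → Vtx n → Vtx n
  neighbour c = descend (neighbourᴸ c)

  neighbour-π : ∀ c ℓ → neighbour c (π ℓ) ≡ π (neighbourᴸ c ℓ)
  neighbour-π c = descend-π (neighbourᴸ-cong c)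

  neighbour-involutive : ∀ c x → neighbour c (neighbour c x) ≡ x
  neighbour-involutive c x = begin
    neighbour c (π (neighbourᴸ c (lift x)))  ≡⟨ neighbour-π c _ ⟩
    π (neighbourᴸ c (neighbourᴸ c (lift x))) ≡⟨ π-cong (neighbourᴸ-involutive c (lift x)) ⟩
    π (lift x)                               ≡⟨ π-lift x ⟩
    x                                        ∎
    where open ≡-Reasoning

  Swaps : (Vtx n → Vtx n) → Set
  Swaps σ = ∀ c x → σ (neighbour c x) ≡ neighbour (swap c) (σ x)

  -- The reflection i ↦ -1-i of ℤ_n.
  reflectᴸ : Label → Label
  reflectᴸ (u K 0F) = u (- K - + 1) 1F
  reflectᴸ (u K 1F) = u (- K - + 1) 0F
  reflectᴸ (v K 0F) = v (- K - + 1) 1F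
  reflectᴸ (v K 1F) = v (- K - + 1) 0F

  reflectᴸ-cong : Congruent reflectᴸ
  reflectᴸ-cong (u≈ {r = 0F} K≡K′) = u≈ (+-congʳ-mod (- + 1) (neg-cong-mod K≡K′))
  reflectᴸ-cong (u≈ {r = 1F} K≡K′) = u≈ (+-congʳ-mod (- + 1) (neg-cong-mod K≡K′))
  reflectᴸ-cong (v≈ {r = 0F} K≡K′) = v≈ (+-congʳ-mod (- + 1) (neg-cong-mod K≡K′))
  reflectᴸ-cong (v≈ {r = 1F} K≡K′) = v≈ (+-congʳ-mod (- + 1) (neg-cong-mod K≡K′))

  reflectᴸ-neighbourᴸ : ∀ c ℓ → neighbourᴸ c (reflectᴸ ℓ) ≈ reflectᴸ (neighbourᴸ c ℓ)
  reflectᴸ-neighbourᴸ red   (u K 0F) = v≈ mod-refl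
  reflectᴸ-neighbourᴸ red   (u K 1F) = v≈ mod-refl
  reflectᴸ-neighbourᴸ red   (v K 0F) = u≈ mod-refl
  reflectᴸ-neighbourᴸ red   (v K 1F) = u≈ mod-refl
  reflectᴸ-neighbourᴸ blue  (u K 0F) = u≈ mod-refl
  reflectᴸ-neighbourᴸ blue  (u K 1F) = u≈ mod-refl
  reflectᴸ-neighbourᴸ blue  (v K 0F) = v≈ (≡⇒≡⟨mod⟩ (solve (K ∷ α ∷ [])))
  reflectᴸ-neighbourᴸ blue  (v K 1F) = v≈ (≡⇒≡⟨mod⟩ (solve (K ∷ α ∷ [])))
  reflectᴸ-neighbourᴸ green (u K 0F) = u≈ (≡⇒≡⟨mod⟩ (solve (K ∷ [])))
  reflectᴸ-neighbourᴸ green (u K 1F) = u≈ (≡⇒≡⟨mod⟩ (solve (K ∷ [])))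
  reflectᴸ-neighbourᴸ green (v K 0F) = v≈ (≡⇒≡⟨mod⟩ (solve (K ∷ β ∷ [])))
  reflectᴸ-neighbourᴸ green (v K 1F) = v≈ (≡⇒≡⟨mod⟩ (solve (K ∷ β ∷ [])))

  reflect : Vtx n → Vtx n
  reflect = descend reflectᴸ

  reflect-neighbour : ∀ c x → neighbour c (reflect x) ≡ reflect (neighbour c x)
  reflect-neighbour c = descend-comm (neighbourᴸ-cong c) reflectᴸ-cong (reflectᴸ-neighbourᴸ c)

  swaps-∘-reflect : ∀ {σ} → Swaps σ → Swaps (σ ∘ reflect)
  swaps-∘-reflect {σ} σ-swaps c x = trans (cong σ (sym (reflect-neighbour c x))) (σ-swaps c (reflect x))

  walkᴸ : List Colour → Label → Label
  walkᴸ []      ℓ = ℓ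
  walkᴸ (c ∷ w) ℓ = walkᴸ w (neighbourᴸ c ℓ)

  walk : List Colour → Vtx n → Vtx n
  walk []      x = x
  walk (c ∷ w) x = walk w (neighbour c x)

  walk-π : ∀ w ℓ → walk w (π ℓ) ≡ π (walkᴸ w ℓ)
  walk-π []      ℓ = refl
  walk-π (c ∷ w) ℓ = trans (cong (walk w) (neighbour-π c ℓ)) (walk-π w (neighbourᴸ c ℓ))

  neighbour-distinct : ∀ c c′ → (∀ ℓ → ¬ (neighbourᴸ c ℓ ≈ neighbourᴸ c′ ℓ)) →
                       ∀ x → neighbour c x ≢ neighbour c′ x
  neighbour-distinct c c′ distinct x eq = distinct (lift x) (π-injective eq)

  green≢red : ∀ x → neighbour green x ≢ neighbour red x
  green≢red = neighbour-distinct green red λ where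
    (u K 0F) () ; (u K 1F) () ; (v K 0F) () ; (v K 1F) ()

  green≢blue : ¬ (+ 1 ≡ + 0 ⟨mod h ⟩) → ¬ (β ≡ α ⟨mod h ⟩) → ∀ x → neighbour green x ≢ neighbour blue x
  green≢blue 1≢0 β≢α = neighbour-distinct green blue λ where
    (u K 0F) (u≈ p) → 1≢0 (mod-by-difference (mod-sym p) (solve (K ∷ [])))
    (u K 1F) (u≈ p) → 1≢0 (mod-by-difference p (solve (K ∷ [])))
    (v K 0F) (v≈ p) → β≢α (mod-by-difference p (solve (K ∷ α ∷ β ∷ [])))
    (v K 1F) (v≈ p) → β≢α (mod-by-difference (mod-sym p) (solve (K ∷ α ∷ β ∷ [])))

module PerfectMatching {n : ℕ} (P : Rel n) (f : Vtx n → Vtx n) (f-involutive : ∀ x → f (f x) ≡ x)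
                       (arc⇒f : ∀ {x y} → P x y → y ≡ f x) (f-arc : ∀ x → P x (f x) ⊎ P (f x) x) where

  Sym⇒≡ : ∀ {x y} → Sym P x y → y ≡ f x
  Sym⇒≡ (inj₁ Pxy) = arc⇒f Pxy
  Sym⇒≡ {x} {y} (inj₂ Pyx) = trans (sym (f-involutive y)) (cong f (sym (arc⇒f Pyx)))

  ≡⇒Sym : ∀ {x y} → y ≡ f x → Sym P x y
  ≡⇒Sym {x} refl = f-arc x

module Edges (n a b h : ℕ) .{{_ : NonZero n}} (n≡2h : n ≡ 2 ℕ.* h) (α β : ℤ)
             (a≡1+2α : + a ≡ + 1 ℤ.+ + 2 ℤ.* α) (b≡1+2β : + b ≡ + 1 ℤ.+ + 2 ℤ.* β) where
  open import Data.Integer using (_+_; _*_; _-_; -_)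
  open import Data.Integer.Tactic.RingSolver
  import Data.Nat.Divisibility as ND
  open Congruence
  open Residues n
  open ColourMaps n h n≡2h α β

  Arcs : Colour → Rel n
  Arcs red   = spokeD n
  Arcs blue  = rimEvenD n ∪ innerD n a
  Arcs green = rimOddD n ∪ innerD n b

  half : Fin n → ℤ
  half j = + (toℕ j ℕ./ 2)

  parity : Fin n → Fin 2
  parity j = toℕ j ℕ.mod 2

  parity-even : ∀ {j} → 2 ND.∣ toℕ j → parity j ≡ 0F
  parity-even e = Fin.toℕ-injective (trans (Fin.toℕ-fromℕ< _) (ND.n∣m⇒m%n≡0 _ 2 e))

  parity-odd : ∀ {j} → ¬ 2 ND.∣ toℕ j → parity j ≡ 1F
  parity-odd {j} o with parity j in eq
  ... | 0F = contradiction (ND.m%n≡0⇒n∣m _ 2 (trans (sym (Fin.toℕ-fromℕ< _)) (cong toℕ eq))) o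
  ... | 1F = refl

  index-even : ∀ {j} → 2 ND.∣ toℕ j → index (half j) 0F ≡ + toℕ j
  index-even {j} e = trans (cong (index (half j)) (sym (parity-even e))) (index-lift j)

  index-odd : ∀ {j} → ¬ 2 ND.∣ toℕ j → index (half j) 1F ≡ + toℕ j
  index-odd {j} o = trans (cong (index (half j)) (sym (parity-odd o))) (index-lift j)

  even-π : ∀ K → 2 ND.∣ toℕ (residue (index K 0F))
  even-π K with 2 ND.∣? toℕ (residue (index K 0F))
  ... | yes e = e
  ... | no o = contradiction (trans (sym (parity-odd o)) (≈-bit (lift-π (u K 0F)))) λ ()

  odd-π : ∀ K → ¬ 2 ND.∣ toℕ (residue (index K 1F))
  odd-π K e = contradiction (trans (sym (parity-even e)) (≈-bit (lift-π (u K 1F)))) λ ()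

  blue-rim : ∀ {i} → 2 ND.∣ toℕ i → neighbour blue (u i) ≡ u (i ⊕ 1)
  blue-rim {i} e = begin
      π (neighbourᴸ blue (u (half i) (parity i)))  ≡⟨ cong (λ r → π (neighbourᴸ blue (u (half i) r))) (parity-even e) ⟩
      u (residue (index (half i) 1F))              ≡⟨ cong (u ∘ residue) (trans (shift (half i)) (cong (_+ + 1) (index-even e))) ⟩
      u (i ⊕ 1)                                    ∎
    where
    open ≡-Reasoning
    shift : ∀ H → + 2 * H + + 1 ≡ (+ 2 * H + + 0) + + 1
    shift = solve-∀

  blue-inner : ∀ {i} → 2 ND.∣ toℕ i → neighbour blue (v i) ≡ v (i ⊕ a)
  blue-inner {i} e = begin
      π (neighbourᴸ blue (v (half i) (parity i)))  ≡⟨ cong (λ r → π (neighbourᴸ blue (v (half i) r))) (parity-even e) ⟩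
      v (residue (index (half i + α) 1F))          ≡⟨ cong (v ∘ residue) (trans (shift (half i) α) (cong₂ _+_ (index-even e) (sym a≡1+2α))) ⟩
      v (i ⊕ a)                                    ∎
    where
    open ≡-Reasoning
    shift : ∀ H α → + 2 * (H + α) + + 1 ≡ (+ 2 * H + + 0) + (+ 1 + + 2 * α)
    shift = solve-∀

  green-rim : ∀ {i} → ¬ 2 ND.∣ toℕ i → neighbour green (u i) ≡ u (i ⊕ 1)
  green-rim {i} o = begin
      π (neighbourᴸ green (u (half i) (parity i)))  ≡⟨ cong (λ r → π (neighbourᴸ green (u (half i) r))) (parity-odd o) ⟩
      u (residue (index (half i + + 1) 0F))         ≡⟨ cong (u ∘ residue) (trans (shift (half i)) (cong (_+ + 1) (index-odd o))) ⟩
      u (i ⊕ 1)                                     ∎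
    where
    open ≡-Reasoning
    shift : ∀ H → + 2 * (H + + 1) + + 0 ≡ (+ 2 * H + + 1) + + 1
    shift = solve-∀

  green-inner : ∀ {i} → 2 ND.∣ toℕ i → neighbour green (v i) ≡ v (i ⊕ b)
  green-inner {i} e = begin
      π (neighbourᴸ green (v (half i) (parity i)))  ≡⟨ cong (λ r → π (neighbourᴸ green (v (half i) r))) (parity-even e) ⟩
      v (residue (index (half i + β) 1F))           ≡⟨ cong (v ∘ residue) (trans (shift (half i) β) (cong₂ _+_ (index-even e) (sym b≡1+2β))) ⟩
      v (i ⊕ b)                                     ∎
    where
    open ≡-Reasoning
    shift : ∀ H β → + 2 * (H + β) + + 1 ≡ (+ 2 * H + + 0) + (+ 1 + + 2 * β)
    shift = solve-∀

  arc⇒neighbour : ∀ c {x y} → Arcs c x y → y ≡ neighbour c x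
  arc⇒neighbour red   (i , refl , refl)                = sym (π-lift (v i))
  arc⇒neighbour blue  (inj₁ (i , e , refl , refl)) = sym (blue-rim e)
  arc⇒neighbour blue  (inj₂ (i , e , refl , refl)) = sym (blue-inner e)
  arc⇒neighbour green (inj₁ (i , o , refl , refl)) = sym (green-rim o)
  arc⇒neighbour green (inj₂ (i , e , refl , refl)) = sym (green-inner e)

  private
    back-arc : ∀ c {x y} (s : Fin n → Vtx n) i → neighbour c x ≡ s i → neighbour c (s i) ≡ y → x ≡ y
    back-arc c {x} s i nx≡si nsi≡y =
      trans (sym (neighbour-involutive c x)) (trans (cong (neighbour c) nx≡si) nsi≡y)

  neighbour-arc : ∀ c x → Arcs c x (neighbour c x) ⊎ Arcs c (neighbour c x) x
  neighbour-arc red (u j) = inj₁ (j , refl , π-lift (v j))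
  neighbour-arc red (v j) = inj₂ (j , π-lift (u j) , refl)
  neighbour-arc blue (u j) with 2 ND.∣? toℕ j
  ... | yes e = inj₁ (inj₁ (j , e , refl , blue-rim e))
  ... | no o  = inj₂ (inj₁ (_ , even-π K , y≡ , back-arc blue u _ y≡ (blue-rim (even-π K))))
    where
    K : ℤ
    K = half j
    y≡ : neighbour blue (u j) ≡ π (u K 0F)
    y≡ = cong (λ r → π (neighbourᴸ blue (u K r))) (parity-odd o)
  neighbour-arc blue (v j) with 2 ND.∣? toℕ j
  ... | yes e = inj₁ (inj₂ (j , e , refl , blue-inner e))
  ... | no o  = inj₂ (inj₂ (_ , even-π K , y≡ , back-arc blue v _ y≡ (blue-inner (even-π K))))
    where
    K : ℤ
    K = half j - α
    y≡ : neighbour blue (v j) ≡ π (v K 0F)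
    y≡ = cong (λ r → π (neighbourᴸ blue (v (half j) r))) (parity-odd o)
  neighbour-arc green (u j) with 2 ND.∣? toℕ j
  ... | no o  = inj₁ (inj₁ (j , o , refl , green-rim o))
  ... | yes e = inj₂ (inj₁ (_ , odd-π K , y≡ , back-arc green u _ y≡ (green-rim (odd-π K))))
    where
    K : ℤ
    K = half j - + 1
    y≡ : neighbour green (u j) ≡ π (u K 1F)
    y≡ = cong (λ r → π (neighbourᴸ green (u (half j) r))) (parity-even e)
  neighbour-arc green (v j) with 2 ND.∣? toℕ j
  ... | yes e = inj₁ (inj₂ (j , e , refl , green-inner e))
  ... | no o  = inj₂ (inj₂ (_ , even-π K , y≡ , back-arc green v _ y≡ (green-inner (even-π K))))
    where
    K : ℤ
    K = half j - β
    y≡ : neighbour green (v j) ≡ π (v K 0F)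
    y≡ = cong (λ r → π (neighbourᴸ green (v (half j) r))) (parity-odd o)

  module _ (c : Colour) where
    open PerfectMatching (Arcs c) (neighbour c) (neighbour-involutive c) (arc⇒neighbour c) (neighbour-arc c)
      renaming (Sym⇒≡ to Sym-arcs⇒neighbour; ≡⇒Sym to neighbour⇒Sym-arcs) public

  Edge⇒Sym-arcs : ∀ {x y} → Edge n a b x y → ∃[ c ] Sym (Arcs c) x y
  Edge⇒Sym-arcs (inj₁ (inj₁ s))                           = red , inj₁ s
  Edge⇒Sym-arcs (inj₁ (inj₂ (inj₁ r)))                    = blue , inj₁ (inj₁ r)
  Edge⇒Sym-arcs (inj₁ (inj₂ (inj₂ (inj₁ r))))             = green , inj₁ (inj₁ r)
  Edge⇒Sym-arcs (inj₁ (inj₂ (inj₂ (inj₂ (inj₁ r)))))      = blue , inj₁ (inj₂ r)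
  Edge⇒Sym-arcs (inj₁ (inj₂ (inj₂ (inj₂ (inj₂ r)))))      = green , inj₁ (inj₂ r)
  Edge⇒Sym-arcs (inj₂ (inj₁ s))                           = red , inj₂ s
  Edge⇒Sym-arcs (inj₂ (inj₂ (inj₁ r)))                    = blue , inj₂ (inj₁ r)
  Edge⇒Sym-arcs (inj₂ (inj₂ (inj₂ (inj₁ r))))             = green , inj₂ (inj₁ r)
  Edge⇒Sym-arcs (inj₂ (inj₂ (inj₂ (inj₂ (inj₁ r)))))      = blue , inj₂ (inj₂ r)
  Edge⇒Sym-arcs (inj₂ (inj₂ (inj₂ (inj₂ (inj₂ r)))))      = green , inj₂ (inj₂ r)

  Sym-arcs⇒Edge : ∀ c {x y} → Sym (Arcs c) x y → Edge n a b x y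
  Sym-arcs⇒Edge red   (inj₁ s)         = inj₁ (inj₁ s)
  Sym-arcs⇒Edge red   (inj₂ s)         = inj₂ (inj₁ s)
  Sym-arcs⇒Edge blue  (inj₁ (inj₁ r))  = inj₁ (inj₂ (inj₁ r))
  Sym-arcs⇒Edge blue  (inj₁ (inj₂ r))  = inj₁ (inj₂ (inj₂ (inj₂ (inj₁ r))))
  Sym-arcs⇒Edge blue  (inj₂ (inj₁ r))  = inj₂ (inj₂ (inj₁ r))
  Sym-arcs⇒Edge blue  (inj₂ (inj₂ r))  = inj₂ (inj₂ (inj₂ (inj₂ (inj₁ r))))
  Sym-arcs⇒Edge green (inj₁ (inj₁ r))  = inj₁ (inj₂ (inj₂ (inj₁ r)))
  Sym-arcs⇒Edge green (inj₁ (inj₂ r))  = inj₁ (inj₂ (inj₂ (inj₂ (inj₂ r))))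
  Sym-arcs⇒Edge green (inj₂ (inj₁ r))  = inj₂ (inj₂ (inj₂ (inj₁ r)))
  Sym-arcs⇒Edge green (inj₂ (inj₂ r))  = inj₂ (inj₂ (inj₂ (inj₂ (inj₂ r))))

  Edge⇒neighbour : ∀ {x y} → Edge n a b x y → ∃[ c ] y ≡ neighbour c x
  Edge⇒neighbour e with Edge⇒Sym-arcs e
  ... | c , s = c , Sym-arcs⇒neighbour c s

  neighbour⇒Edge : ∀ c {x y} → y ≡ neighbour c x → Edge n a b x y
  neighbour⇒Edge c eq = Sym-arcs⇒Edge c (neighbour⇒Sym-arcs c eq)

  module _ (condA : CondA n a b) where

    B⇒Sym-arcs : ∀ {x y} → B n a b x y → Sym (Arcs blue) x y
    B⇒Sym-arcs (inj₁ (inj₁ r))           = inj₁ (inj₁ r)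
    B⇒Sym-arcs (inj₁ (inj₂ r))           = inj₂ (inj₁ r)
    B⇒Sym-arcs (inj₂ (inj₁ (_ , inj₁ r))) = inj₁ (inj₂ r)
    B⇒Sym-arcs (inj₂ (inj₁ (_ , inj₂ r))) = inj₂ (inj₂ r)
    B⇒Sym-arcs (inj₂ (inj₂ (¬condA , _))) = contradiction condA ¬condA

    Sym-arcs⇒B : ∀ {x y} → Sym (Arcs blue) x y → B n a b x y
    Sym-arcs⇒B (inj₁ (inj₁ r)) = inj₁ (inj₁ r)
    Sym-arcs⇒B (inj₂ (inj₁ r)) = inj₁ (inj₂ r)
    Sym-arcs⇒B (inj₁ (inj₂ r)) = inj₂ (inj₁ (condA , inj₁ r))
    Sym-arcs⇒B (inj₂ (inj₂ r)) = inj₂ (inj₁ (condA , inj₂ r))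

module Symmetries (n a b h : ℕ) .{{_ : NonZero n}} (n≡2h : n ≡ 2 ℕ.* h) (α β : ℤ)
                  (a≡1+2α : + a ≡ + 1 ℤ.+ + 2 ℤ.* α) (b≡1+2β : + b ≡ + 1 ℤ.+ + 2 ℤ.* β)
                  (condA : CondA n a b) where
  open ColourMaps n h n≡2h α β
  open Edges n a b h n≡2h α β a≡1+2α b≡1+2β

  ColourSwapping : (Vtx n → Vtx n) → Set
  ColourSwapping σ = IsAutomorphism (Edge n a b) σ × MapsOnto σ (B n a b) (R n a b) × MapsOnto σ (R n a b) (B n a b)

  B⇒neighbour : ∀ {x y} → B n a b x y → y ≡ neighbour blue x
  B⇒neighbour = Sym-arcs⇒neighbour blue ∘ B⇒Sym-arcs condA

  neighbour⇒B : ∀ {x y} → y ≡ neighbour blue x → B n a b x y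
  neighbour⇒B = Sym-arcs⇒B condA ∘ neighbour⇒Sym-arcs blue

  swaps-of-colour-swapping : (∀ x → neighbour green x ≢ neighbour blue x) →
                             ∀ {σ} → ColourSwapping σ → Swaps σ
  swaps-of-colour-swapping green≢blue {σ} (((σ-injective , _) , σ-edge) , (B↦R , _) , (R↦B , _)) = σ-swaps
    where
    σ-swaps : Swaps σ
    σ-swaps red   x = B⇒neighbour (R↦B x _ (neighbour⇒Sym-arcs red refl))
    σ-swaps blue  x = Sym-arcs⇒neighbour red (B↦R x _ (neighbour⇒B refl))
    σ-swaps green x with Edge⇒neighbour (proj₁ (σ-edge x _) (neighbour⇒Edge green refl))
    ... | green , eq = eq
    ... | red   , eq = contradiction (σ-injective (trans eq (sym (σ-swaps blue x)))) (green≢blue x)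
    ... | blue  , eq = contradiction (σ-injective (trans eq (sym (σ-swaps red x)))) (green≢red x)

  colour-swapping-of-swaps : ∀ {σ} → Swaps σ → (∀ x → σ (σ x) ≡ x) → ColourSwapping σ
  colour-swapping-of-swaps {σ} σ-swaps σ-involutive =
    ((σ-injective , λ y → σ y , λ eq → trans (cong σ eq) (σ-involutive y)) , λ x y → edge-preserved , edge-reflected) ,
    ((λ x y → blue↦red) , (λ x y Rxy → σ x , σ y , red↦blue Rxy , σ-involutive x , σ-involutive y)) ,
    ((λ x y → red↦blue) , (λ x y Bxy → σ x , σ y , blue↦red Bxy , σ-involutive x , σ-involutive y))
    where
    σ-injective : Injective _≡_ _≡_ σ
    σ-injective {x} {y} eq = trans (sym (σ-involutive x)) (trans (cong σ eq) (σ-involutive y))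

    σ-neighbour : ∀ c {x y} → y ≡ neighbour c x → σ y ≡ neighbour (swap c) (σ x)
    σ-neighbour c {x} refl = σ-swaps c x

    edge-preserved : ∀ {x y} → Edge n a b x y → Edge n a b (σ x) (σ y)
    edge-preserved e with Edge⇒neighbour e
    ... | c , eq = neighbour⇒Edge (swap c) (σ-neighbour c eq)

    edge-reflected : ∀ {x y} → Edge n a b (σ x) (σ y) → Edge n a b x y
    edge-reflected {x} {y} e with Edge⇒neighbour e
    ... | c , eq = neighbour⇒Edge (swap c) (begin
        y                                ≡⟨ σ-involutive y ⟨
        σ (σ y)                          ≡⟨ σ-neighbour c eq ⟩
        neighbour (swap c) (σ (σ x))     ≡⟨ cong (neighbour (swap c)) (σ-involutive x) ⟩
        neighbour (swap c) x             ∎)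
      where open ≡-Reasoning

    recolour : ∀ c {x y} → Sym (Arcs c) x y → Sym (Arcs (swap c)) (σ x) (σ y)
    recolour c s = neighbour⇒Sym-arcs (swap c) (σ-neighbour c (Sym-arcs⇒neighbour c s))

    blue↦red : ∀ {x y} → B n a b x y → R n a b (σ x) (σ y)
    blue↦red = recolour blue ∘ B⇒Sym-arcs condA

    red↦blue : ∀ {x y} → R n a b x y → B n a b (σ x) (σ y)
    red↦blue = Sym-arcs⇒B condA ∘ recolour red

even-or-odd : ∀ m → (∃[ q ] m ≡ 2 ℕ.* q) ⊎ (∃[ q ] m ≡ 1 ℕ.+ 2 ℕ.* q)
even-or-odd zero = inj₁ (0 , refl)
even-or-odd (suc m) with even-or-odd m
... | inj₁ (q , refl) = inj₂ (q , refl)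
... | inj₂ (q , refl) = inj₁ (suc q , cong suc (sym (ℕ.+-suc q (q ℕ.+ 0))))

record NecessaryCongruences (h α₀ β₀ : ℕ) : Set where
  field
    b₀ p          : ℕ
    β₀≡1+2b₀      : β₀ ≡ 1 ℕ.+ 2 ℕ.* b₀
    α₀≡2p         : α₀ ≡ 2 ℕ.* p
    p-congruence  : + 2 ℤ.* + p ℤ.* (+ b₀ ℤ.+ + 2) ≡ + 0 ⟨mod h ⟩
    b₀-congruence : (+ 2 ℤ.* (+ b₀ ℤ.+ + 1) ℤ.* (+ b₀ ℤ.+ + 1) ≡ + 2 ⟨mod h ⟩)
                  ⊎ (+ 2 ℤ.* + b₀ ℤ.* + b₀ ℤ.+ + 4 ℤ.* + p ≡ + 0 ⟨mod h ⟩)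

module Necessity (n h α₀ β₀ : ℕ) .{{_ : NonZero n}} (n≡2h : n ≡ 2 ℕ.* h) where
  open import Data.Integer using (_+_; _*_; _-_; -_)
  open import Data.Integer.Divisibility.Signed using (divides; ∣⇒∣ᵤ)
  open import Data.Integer.Tactic.RingSolver
  open Congruence
  open ColourMaps n h n≡2h (+ α₀) (+ β₀)

  α β c : ℤ
  α = + α₀
  β = + β₀
  c = β + + 1

  +suc : ∀ j → + suc j ≡ + j + + 1
  +suc j = trans (ℤ.pos-+ 1 j) (ℤ.+-comm (+ 1) (+ j))

  multiple-of-h : ∀ {x y} k → x - y ≡ k * + h → x ≡ y ⟨mod h ⟩
  multiple-of-h k eq = mod⟨ divides k eq ⟩

  β₀-odd : ∀ q → h ≡ 2 ℕ.* q → + q * c ≡ + 0 ⟨mod h ⟩ → ∃[ b₀ ] β₀ ≡ 1 ℕ.+ 2 ℕ.* b₀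
  β₀-odd q h≡2q qc≡0 with ND.*-cancelʳ-∣ q {{ℕ.≢-nonZero q≢0}} 2q∣[β₀+1]q
    where
    q≢0 : q ≢ 0
    q≢0 refl = ℕ.≢-nonZero⁻¹ n (trans n≡2h (cong (2 ℕ.*_) h≡2q))
    2q∣[β₀+1]q : 2 ℕ.* q ND.∣ (β₀ ℕ.+ 1) ℕ.* q
    2q∣[β₀+1]q = subst₂ ND._∣_ h≡2q
      (trans (cong ℤ.∣_∣ (trans (ℤ.+-identityʳ _) (sym (ℤ.pos-* q (β₀ ℕ.+ 1))))) (ℕ.*-comm q (β₀ ℕ.+ 1)))
      (∣⇒∣ᵤ (∣-difference qc≡0))
  ... | 2∣β₀+1 with even-or-odd β₀
  ...   | inj₂ β₀≡1+2b₀ = β₀≡1+2b₀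
  ...   | inj₁ (k , β₀≡2k) =
    contradiction (ND.∣1⇒≡1 (ND.∣m+n∣m⇒∣n (subst (λ x → 2 ND.∣ x ℕ.+ 1) β₀≡2k 2∣β₀+1) (ND.m∣m*n k))) λ ()

  half-turn-odd : ∀ q → h ≡ 1 ℕ.+ 2 ℕ.* q → - (+ 2 * + suc q) ≡ + 0 - + 1 ⟨mod h ⟩
  half-turn-odd q h≡1+2q = multiple-of-h (- + 1) (wrap (+ suc q) (+ q) (+ h) (+suc q) (pos-odd q h≡1+2q))
    where
    wrap : ∀ Q′ Q H → Q′ ≡ Q + + 1 → H ≡ + 1 + + 2 * Q → - (+ 2 * Q′) - (+ 0 - + 1) ≡ - + 1 * H
    wrap _ Q _ refl refl = solve (Q ∷ [])

  half-turn-even : ∀ q → h ≡ 2 ℕ.* q → - (+ 2 * + q) ≡ + 0 ⟨mod h ⟩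
  half-turn-even q h≡2q = multiple-of-h (- + 1) (wrap (+ q) (+ h) (pos-even q h≡2q))
    where
    wrap : ∀ Q H → H ≡ + 2 * Q → - (+ 2 * Q) - + 0 ≡ - + 1 * H
    wrap Q _ refl = solve (Q ∷ [])

  module Swapping (σ : Vtx n → Vtx n) (σ-swaps : Swaps σ) where

    σ-walk : ∀ w x → σ (walk w x) ≡ walk (map swap w) (σ x)
    σ-walk []      x = refl
    σ-walk (c ∷ w) x = trans (σ-walk w (neighbour c x)) (cong (walk (map swap w)) (σ-swaps c x))

    infix 4 _↦_
    record _↦_ (ℓ₀ ℓ₁ : Label) : Set where
      constructor sends
      field image : σ (π ℓ₀) ≡ π ℓ₁
    open _↦_

    σ-along : ∀ w {ℓ₀ ℓ₁} → ℓ₀ ↦ ℓ₁ → walkᴸ w ℓ₀ ↦ walkᴸ (map swap w) ℓ₁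
    σ-along w {ℓ₀} {ℓ₁} (sends eq) = sends (begin
      σ (π (walkᴸ w ℓ₀))            ≡⟨ cong σ (walk-π w ℓ₀) ⟨
      σ (walk w (π ℓ₀))             ≡⟨ σ-walk w (π ℓ₀) ⟩
      walk (map swap w) (σ (π ℓ₀))  ≡⟨ cong (walk (map swap w)) eq ⟩
      walk (map swap w) (π ℓ₁)      ≡⟨ walk-π (map swap w) ℓ₁ ⟩
      π (walkᴸ (map swap w) ℓ₁)     ∎)
      where open ≡-Reasoning

    images-agree : ∀ {ℓ₁ ℓ₂ X Y} → ℓ₁ ≈ ℓ₂ → ℓ₁ ↦ X → ℓ₂ ↦ Y → X ≈ Y
    images-agree ℓ₁≈ℓ₂ (sends eq₁) (sends eq₂) = π-injective (trans (sym eq₁) (trans (cong σ (π-cong ℓ₁≈ℓ₂)) eq₂))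

    module OuterBase (I : ℤ) (base : u (+ 0) 0F ↦ u I 0F) where

      orbit : ∀ j → u (- (+ 2 * + j)) 0F ↦ u (I - + j * c) 0F
      orbit zero    = subst (u (+ 0) 0F ↦_) (cong (λ K → u K 0F) (minus-zero I c)) base
        where
        minus-zero : ∀ I c → I ≡ I - + 0 * c
        minus-zero = solve-∀
      orbit (suc j) = subst₂ _↦_ (cong (λ K → u K 0F) (four-steps (+ suc j) (+ j) (+suc j)))
                                 (cong (λ K → u K 0F) (one-period I (+ suc j) (+ j) β (+suc j)))
                                 (σ-along (green ∷ blue ∷ green ∷ blue ∷ []) (orbit j))
        where
        four-steps : ∀ J′ J → J′ ≡ J + + 1 → - (+ 2 * J) - + 1 - + 1 ≡ - (+ 2 * J′)
        four-steps _ J refl = solve (J ∷ [])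
        one-period : ∀ I J′ J B → J′ ≡ J + + 1 → I - J * (B + + 1) - + 1 - B ≡ I - J′ * (B + + 1)
        one-period I _ J B refl = solve (I ∷ J ∷ B ∷ [])

      h-even : ∃[ q ] h ≡ 2 ℕ.* q
      h-even with even-or-odd h
      ... | inj₁ h≡2q = h≡2q
      ... | inj₂ (q , h≡1+2q) =
        ⊥-elim (u≉v (images-agree (u≈ (half-turn-odd q h≡1+2q)) (orbit (suc q)) (σ-along (green ∷ blue ∷ []) base)))

      q : ℕ
      q = proj₁ h-even

      h≡2q : h ≡ 2 ℕ.* q
      h≡2q = proj₂ h-even

      β₀-odd′ : ∃[ b₀ ] β₀ ≡ 1 ℕ.+ 2 ℕ.* b₀
      β₀-odd′ = β₀-odd q h≡2q (mod-by-difference (mod-sym (u≈⁻¹ closes)) (cancel I (+ q * c)))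
        where
        closes : u (I - + q * c) 0F ≈ u I 0F
        closes = images-agree (u≈ (half-turn-even q h≡2q)) (orbit q) base
        cancel : ∀ I X → I - (I - X) ≡ X - + 0
        cancel = solve-∀

      b₀ : ℕ
      b₀ = proj₁ β₀-odd′

      β≡1+2b₀ : β ≡ + 1 + + 2 * + b₀
      β≡1+2b₀ = pos-odd b₀ (proj₂ β₀-odd′)

      α₀-even : ∃[ p ] α₀ ≡ 2 ℕ.* p
      α₀-even with even-or-odd α₀
      ... | inj₁ α₀≡2p = α₀≡2p
      ... | inj₂ (p , α₀≡1+2p) = ⊥-elim (v≉u (images-agree (v≈ (≡⇒≡⟨mod⟩ (lands (+ suc p) (+ p) α (+suc p) (pos-odd p α₀≡1+2p))))
                                                          (σ-along (red ∷ blue ∷ []) (orbit (suc p)))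
                                                          (σ-along (green ∷ red ∷ []) base)))
        where
        lands : ∀ P′ P A → P′ ≡ P + + 1 → A ≡ + 1 + + 2 * P → - (+ 2 * P′) + A ≡ + 0 - + 1
        lands _ P _ refl refl = solve (P ∷ [])

      p : ℕ
      p = proj₁ α₀-even

      α≡2p : α ≡ + 2 * + p
      α≡2p = pos-even p (proj₂ α₀-even)

      p-congruence : + 2 * + p * (+ b₀ + + 2) ≡ + 0 ⟨mod h ⟩
      p-congruence = mod-by-difference (mod-sym (v≈⁻¹ agree)) (difference I (+ suc p) (+ p) (+ b₀) α β (+suc p) α≡2p β≡1+2b₀)
        where
        lands : ∀ P′ P A → P′ ≡ P + + 1 → A ≡ + 2 * P → - (+ 2 * P′) + A ≡ + 0 - + 1 - + 1
        lands _ P _ refl refl = solve (P ∷ [])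
        agree : v (I - + suc p * c) 1F ≈ v (I - + 1 - β + α) 1F
        agree = images-agree (v≈ (≡⇒≡⟨mod⟩ (lands (+ suc p) (+ p) α (+suc p) α≡2p)))
                             (σ-along (red ∷ blue ∷ []) (orbit (suc p)))
                             (σ-along (green ∷ blue ∷ green ∷ red ∷ []) base)
        difference : ∀ I P′ P N A B → P′ ≡ P + + 1 → A ≡ + 2 * P → B ≡ + 1 + + 2 * N →
                     (I - + 1 - B + A) - (I - P′ * (B + + 1)) ≡ + 2 * P * (N + + 2) - + 0
        difference I _ P N _ _ refl refl refl = solve (I ∷ P ∷ N ∷ [])

      b₀-congruence : + 2 * (+ b₀ + + 1) * (+ b₀ + + 1) ≡ + 2 ⟨mod h ⟩
      b₀-congruence = mod-by-difference (mod-sym (u≈⁻¹ agree)) (difference I (+ suc b₀) (+ b₀) β (+suc b₀) β≡1+2b₀)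
        where
        lands : ∀ M N B → M ≡ N + + 1 → B ≡ + 1 + + 2 * N → - (+ 2 * M) + B ≡ + 0 - + 1
        lands _ N _ refl refl = solve (N ∷ [])
        agree : u (I - + suc b₀ * c + + 1) 0F ≈ u (I - + 1) 0F
        agree = images-agree (v≈ (≡⇒≡⟨mod⟩ (lands (+ suc b₀) (+ b₀) β (+suc b₀) β≡1+2b₀)))
                             (σ-along (red ∷ green ∷ []) (orbit (suc b₀)))
                             (σ-along (green ∷ red ∷ []) base)
        difference : ∀ I M N B → M ≡ N + + 1 → B ≡ + 1 + + 2 * N →
                     (I - + 1) - (I - M * (B + + 1) + + 1) ≡ + 2 * (N + + 1) * (N + + 1) - + 2
        difference I _ N _ refl refl = solve (I ∷ N ∷ [])

      conditions : NecessaryCongruences h α₀ β₀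
      conditions = record
        { b₀ = b₀ ; p = p ; β₀≡1+2b₀ = proj₂ β₀-odd′ ; α₀≡2p = proj₂ α₀-even
        ; p-congruence = p-congruence ; b₀-congruence = inj₁ b₀-congruence }

    module InnerBase (I : ℤ) (base : u (+ 0) 0F ↦ v I 0F) where

      orbit : ∀ j → u (- (+ 2 * + j)) 0F ↦ v (I + + j * c) 0F
      orbit zero    = subst (u (+ 0) 0F ↦_) (cong (λ K → v K 0F) (plus-zero I c)) base
        where
        plus-zero : ∀ I c → I ≡ I + + 0 * c
        plus-zero = solve-∀
      orbit (suc j) = subst₂ _↦_ (cong (λ K → u K 0F) (four-steps (+ suc j) (+ j) (+suc j)))
                                 (cong (λ K → v K 0F) (one-period I (+ suc j) (+ j) β (+suc j)))
                                 (σ-along (green ∷ blue ∷ green ∷ blue ∷ []) (orbit j))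
        where
        four-steps : ∀ J′ J → J′ ≡ J + + 1 → - (+ 2 * J) - + 1 - + 1 ≡ - (+ 2 * J′)
        four-steps _ J refl = solve (J ∷ [])
        one-period : ∀ I J′ J B → J′ ≡ J + + 1 → I + J * (B + + 1) + B + + 1 ≡ I + J′ * (B + + 1)
        one-period I _ J B refl = solve (I ∷ J ∷ B ∷ [])

      h-even : ∃[ q ] h ≡ 2 ℕ.* q
      h-even with even-or-odd h
      ... | inj₁ h≡2q = h≡2q
      ... | inj₂ (q , h≡1+2q) =
        ⊥-elim (v≉u (images-agree (u≈ (half-turn-odd q h≡1+2q)) (orbit (suc q)) (σ-along (green ∷ blue ∷ []) base)))

      q : ℕ
      q = proj₁ h-even

      h≡2q : h ≡ 2 ℕ.* q
      h≡2q = proj₂ h-even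

      β₀-odd′ : ∃[ b₀ ] β₀ ≡ 1 ℕ.+ 2 ℕ.* b₀
      β₀-odd′ = β₀-odd q h≡2q (mod-by-difference (v≈⁻¹ closes) (cancel I (+ q * c)))
        where
        closes : v (I + + q * c) 0F ≈ v I 0F
        closes = images-agree (u≈ (half-turn-even q h≡2q)) (orbit q) base
        cancel : ∀ I X → I + X - I ≡ X - + 0
        cancel = solve-∀

      b₀ : ℕ
      b₀ = proj₁ β₀-odd′

      β≡1+2b₀ : β ≡ + 1 + + 2 * + b₀
      β≡1+2b₀ = pos-odd b₀ (proj₂ β₀-odd′)

      α₀-even : ∃[ p ] α₀ ≡ 2 ℕ.* p
      α₀-even with even-or-odd α₀
      ... | inj₁ α₀≡2p = α₀≡2p
      ... | inj₂ (p , α₀≡1+2p) = ⊥-elim (u≉v (images-agree (v≈ (≡⇒≡⟨mod⟩ (lands (+ suc p) (+ p) α (+suc p) (pos-odd p α₀≡1+2p))))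
                                                          (σ-along (red ∷ blue ∷ []) (orbit (suc p)))
                                                          (σ-along (green ∷ red ∷ []) base)))
        where
        lands : ∀ P′ P A → P′ ≡ P + + 1 → A ≡ + 1 + + 2 * P → - (+ 2 * P′) + A ≡ + 0 - + 1
        lands _ P _ refl refl = solve (P ∷ [])

      p : ℕ
      p = proj₁ α₀-even

      α≡2p : α ≡ + 2 * + p
      α≡2p = pos-even p (proj₂ α₀-even)

      p-congruence : + 2 * + p * (+ b₀ + + 2) ≡ + 0 ⟨mod h ⟩
      p-congruence = mod-by-difference (u≈⁻¹ agree) (difference I (+ suc p) (+ p) (+ b₀) α β (+suc p) α≡2p β≡1+2b₀)
        where
        lands : ∀ P′ P A → P′ ≡ P + + 1 → A ≡ + 2 * P → - (+ 2 * P′) + A ≡ + 0 - + 1 - + 1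
        lands _ P _ refl refl = solve (P ∷ [])
        agree : u (I + + suc p * c + α) 1F ≈ u (I + β + + 1) 1F
        agree = images-agree (v≈ (≡⇒≡⟨mod⟩ (lands (+ suc p) (+ p) α (+suc p) α≡2p)))
                             (σ-along (red ∷ blue ∷ []) (orbit (suc p)))
                             (σ-along (green ∷ blue ∷ green ∷ red ∷ []) base)
        difference : ∀ I P′ P N A B → P′ ≡ P + + 1 → A ≡ + 2 * P → B ≡ + 1 + + 2 * N →
                     (I + P′ * (B + + 1) + A) - (I + B + + 1) ≡ + 2 * P * (N + + 2) - + 0
        difference I _ P N _ _ refl refl refl = solve (I ∷ P ∷ N ∷ [])

      b₀-congruence : + 2 * + b₀ * + b₀ + + 4 * + p ≡ + 0 ⟨mod h ⟩
      b₀-congruence = mod-by-difference (v≈⁻¹ agree) (difference I (+ suc b₀) (+ b₀) (+ p) α β (+suc b₀) α≡2p β≡1+2b₀)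
        where
        lands : ∀ M N B → M ≡ N + + 1 → B ≡ + 1 + + 2 * N → - (+ 2 * M) + B ≡ + 0 - + 1
        lands _ N _ refl refl = solve (N ∷ [])
        agree : v (I + + suc b₀ * c + α - β) 0F ≈ v (I + β - α) 0F
        agree = images-agree (v≈ (≡⇒≡⟨mod⟩ (lands (+ suc b₀) (+ b₀) β (+suc b₀) β≡1+2b₀)))
                             (σ-along (red ∷ green ∷ []) (orbit (suc b₀)))
                             (σ-along (green ∷ red ∷ []) base)
        difference : ∀ I M N P A B → M ≡ N + + 1 → A ≡ + 2 * P → B ≡ + 1 + + 2 * N →
                     (I + M * (B + + 1) + A - B) - (I + B - A) ≡ + 2 * N * N + + 4 * P - + 0
        difference I _ N P _ _ refl refl refl = solve (I ∷ N ∷ P ∷ [])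

      conditions : NecessaryCongruences h α₀ β₀
      conditions = record
        { b₀ = b₀ ; p = p ; β₀≡1+2b₀ = proj₂ β₀-odd′ ; α₀≡2p = proj₂ α₀-even
        ; p-congruence = p-congruence ; b₀-congruence = inj₂ b₀-congruence }

  necessary-congruences : ∀ σ → Swaps σ → NecessaryCongruences h α₀ β₀
  -- σ ∘ reflect sends u_0 to the green neighbour of σ(u_0), whose index has the other parity.
  necessary-congruences σ σ-swaps = from-label (lift (σ (π (u (+ 0) 0F)))) (sym (π-lift _))
    where
    reflected : ∀ {ℓ} → σ (π (u (+ 0) 0F)) ≡ π ℓ → σ (reflect (π (u (+ 0) 0F))) ≡ π (neighbourᴸ green ℓ)
    reflected {ℓ} eq = begin
      σ (reflect (π (u (+ 0) 0F)))      ≡⟨ cong σ (descend-π reflectᴸ-cong (u (+ 0) 0F)) ⟩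
      σ (π (u (+ 0 - + 1) 1F))          ≡⟨ cong σ (neighbour-π green (u (+ 0) 0F)) ⟨
      σ (neighbour green (π (u (+ 0) 0F))) ≡⟨ σ-swaps green _ ⟩
      neighbour green (σ (π (u (+ 0) 0F))) ≡⟨ cong (neighbour green) eq ⟩
      neighbour green (π ℓ)             ≡⟨ neighbour-π green ℓ ⟩
      π (neighbourᴸ green ℓ)            ∎
      where open ≡-Reasoning

    module Reflected = Swapping (σ ∘ reflect) (swaps-∘-reflect σ-swaps)

    from-label : ∀ ℓ → σ (π (u (+ 0) 0F)) ≡ π ℓ → NecessaryCongruences h α₀ β₀
    from-label (u I 0F) eq = Swapping.OuterBase.conditions σ σ-swaps I (Swapping.sends eq)
    from-label (v I 0F) eq = Swapping.InnerBase.conditions σ σ-swaps I (Swapping.sends eq)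
    from-label (u I 1F) eq = Reflected.OuterBase.conditions (I + + 1) (Reflected.sends (reflected {u I 1F} eq))
    from-label (v I 1F) eq = Reflected.InnerBase.conditions (I - β) (Reflected.sends (reflected {v I 1F} eq))

ArithmeticCondition : ℕ → ℕ → ℕ → Set
ArithmeticCondition n a b =
  8 ND.∣ n × ∃[ b₀ ] (b ≡ 4 ℕ.* b₀ ℕ.+ 3 × 4 ℕ.* b ℕ.< 3 ℕ.* n ℕ.+ 4 × 0 ℕ.< b₀ × 2 ND.∣ b₀
                     × ((+ (4 ℕ.* (b₀ ℕ.+ 1) ℕ.^ 2)) ≡ (+ 4) [mod n ]))
  × (+ a) ≡ (+ b) ℤ.- (+ (n ℕ./ 2)) ℤ.- (+ 2)

SquareCondition : ℕ → ℕ → ℕ → Set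
SquareCondition n a b = (+ ((b ℕ.∸ a) ℕ.* ((b ℕ.∸ a) ℕ./ 2))) ≡ (+ 2) [mod n ]

pos-4*square : ∀ x → + (4 ℕ.* x ℕ.^ 2) ≡ + 4 ℤ.* (+ x ℤ.* (+ x ℤ.* + 1))
pos-4*square x = trans (ℤ.pos-* 4 (x ℕ.^ 2)) (cong (+ 4 ℤ.*_) (trans (ℤ.pos-* x (x ℕ.* 1)) (cong (+ x ℤ.*_) (ℤ.pos-* x 1))))

only-multiple-below-double : ∀ {h x} → h ND.∣ x → 0 ℕ.< x → x ℕ.< 2 ℕ.* h → x ≡ h
only-multiple-below-double (ND.divides zero refl) () _
only-multiple-below-double {h} (ND.divides (suc zero) refl) _ _ = ℕ.+-identityʳ h
only-multiple-below-double {h} (ND.divides (suc (suc q)) refl) _ x<2h =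
  contradiction x<2h (ℕ.≤⇒≯ (ℕ.+-monoʳ-≤ h (ℕ.+-monoʳ-≤ h ℕ.z≤n)))

module Arithmetic (n h : ℕ) .{{_ : NonZero n}} (n≡2h : n ≡ 2 ℕ.* h) where
  open import Data.Integer using (_+_; _*_; _-_; -_)
  open import Data.Integer.Divisibility.Signed using (divides; ∣⇒∣ᵤ)
  open import Data.Integer.Tactic.RingSolver
  import Data.Nat.Tactic.RingSolver as ℕ-Solver
  open Congruence

  halve : ∀ {x y} → + 2 * x ≡ + 2 * y ⟨mod n ⟩ → x ≡ y ⟨mod h ⟩
  halve {x} {y} = *-cancelˡ-mod 2 ∘ subst (λ k → + 2 * x ≡ + 2 * y ⟨mod k ⟩) n≡2h

  double : ∀ {x y} → x ≡ y ⟨mod h ⟩ → + 2 * x ≡ + 2 * y ⟨mod n ⟩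
  double {x} {y} = subst (λ k → + 2 * x ≡ + 2 * y ⟨mod k ⟩) (sym n≡2h) ∘ *-congˡ-mod 2

  -- a = 4p+1 and b = 4b₀+3 with b₀ = p+s, s = k+1, so that b - a = 4s+2.
  module Derivation (p k : ℕ) where

    s b₀ a b : ℕ
    s  = suc k
    b₀ = suc (p ℕ.+ k)
    a  = 1 ℕ.+ 2 ℕ.* (2 ℕ.* p)
    b  = 1 ℕ.+ 2 ℕ.* (1 ℕ.+ 2 ℕ.* b₀)

    P S B₀ : ℤ
    P  = + p
    S  = + s
    B₀ = + b₀

    B₀≡P+S : B₀ ≡ P + S
    B₀≡P+S = trans (cong +_ (sym (ℕ.+-suc p k))) (ℤ.pos-+ p s)

    +a : + a ≡ + 1 + + 2 * (+ 2 * P)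
    +a = trans (pos-odd (2 ℕ.* p) refl) (cong (λ x → + 1 + + 2 * x) (pos-even p refl))

    +b : + b ≡ + 1 + + 2 * (+ 1 + + 2 * B₀)
    +b = trans (pos-odd (1 ℕ.+ 2 ℕ.* b₀) refl) (cong (λ x → + 1 + + 2 * x) (pos-odd b₀ refl))

    half-of-a-1 : (a ℕ.∸ 1) ℕ./ 2 ≡ 2 ℕ.* p
    half-of-a-1 = trans (cong (ℕ._/ 2) (ℕ.*-comm 2 (2 ℕ.* p))) (ℕ.m*n/n≡m (2 ℕ.* p) 2)

    b∸a : b ℕ.∸ a ≡ 2 ℕ.* (1 ℕ.+ 2 ℕ.* s)
    b∸a = trans (cong (ℕ._∸ a) (split p k)) (ℕ.m+n∸m≡n a (2 ℕ.* (1 ℕ.+ 2 ℕ.* s)))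
      where
      split : ∀ p k → 1 ℕ.+ 2 ℕ.* (1 ℕ.+ 2 ℕ.* (1 ℕ.+ (p ℕ.+ k)))
                    ≡ (1 ℕ.+ 2 ℕ.* (2 ℕ.* p)) ℕ.+ 2 ℕ.* (1 ℕ.+ 2 ℕ.* (1 ℕ.+ k))
      split = ℕ-Solver.solve-∀

    half-of-b∸a : (b ℕ.∸ a) ℕ./ 2 ≡ 1 ℕ.+ 2 ℕ.* s
    half-of-b∸a = trans (cong (ℕ._/ 2) (trans b∸a (ℕ.*-comm 2 (1 ℕ.+ 2 ℕ.* s)))) (ℕ.m*n/n≡m (1 ℕ.+ 2 ℕ.* s) 2)

    +1+2S : + (1 ℕ.+ 2 ℕ.* s) ≡ + 1 + + 2 * S
    +1+2S = pos-odd s refl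

    module _ (condA : CondA n a b) (square : SquareCondition n a b)
             (p-congruence : + 2 * P * (B₀ + + 2) ≡ + 0 ⟨mod h ⟩)
             (b₀-congruence : (+ 2 * (B₀ + + 1) * (B₀ + + 1) ≡ + 2 ⟨mod h ⟩) ⊎ (+ 2 * B₀ * B₀ + + 4 * P ≡ + 0 ⟨mod h ⟩))
             (b<n : b ℕ.< n) (b+a<n : b ℕ.+ a ℕ.< n) where

      4PS≡0 : + 4 * P * S ≡ + 0 ⟨mod h ⟩
      4PS≡0 = halve (mod-by-difference (mod-sym condA′) (difference (+ a) Q (+ b) B₀ P S +a Q≡2P +b B₀≡P+S))
        where
        Q : ℤ
        Q = + ((a ℕ.∸ 1) ℕ./ 2)
        Q≡2P : Q ≡ + 2 * P
        Q≡2P = pos-even p half-of-a-1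
        condA′ : + a + Q * (+ a - + b) ≡ + 1 ⟨mod n ⟩
        condA′ = [mod]⇒⟨mod⟩ (+ a + Q * (+ a - + b)) (+ 1) condA
        difference : ∀ A Q B′ B P S → A ≡ + 1 + + 2 * (+ 2 * P) → Q ≡ + 2 * P → B′ ≡ + 1 + + 2 * (+ 1 + + 2 * B) → B ≡ P + S →
                     + 1 - (A + Q * (A - B′)) ≡ + 2 * (+ 4 * P * S) - + 2 * + 0
        difference _ _ _ _ P S refl refl refl refl = solve (P ∷ S ∷ [])

      4S[S+1]≡0 : + 4 * S * (S + + 1) ≡ + 0 ⟨mod h ⟩
      4S[S+1]≡0 = halve (mod-by-difference ([mod]⇒⟨mod⟩ D (+ 2) square) (difference D S D≡))
        where
        D : ℤ
        D = + ((b ℕ.∸ a) ℕ.* ((b ℕ.∸ a) ℕ./ 2))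
        D≡ : D ≡ (+ 2 * (+ 1 + + 2 * S)) * (+ 1 + + 2 * S)
        D≡ = trans (cong₂ (λ x y → + (x ℕ.* y)) b∸a half-of-b∸a)
               (trans (ℤ.pos-* (2 ℕ.* (1 ℕ.+ 2 ℕ.* s)) (1 ℕ.+ 2 ℕ.* s))
                      (cong₂ _*_ (trans (ℤ.pos-* 2 (1 ℕ.+ 2 ℕ.* s)) (cong (+ 2 *_) +1+2S)) +1+2S))
        difference : ∀ D S → D ≡ (+ 2 * (+ 1 + + 2 * S)) * (+ 1 + + 2 * S) →
                     D - + 2 ≡ + 2 * (+ 4 * S * (S + + 1)) - + 2 * + 0
        difference _ S refl = solve (S ∷ [])

      4S≡0 : + 4 * S ≡ + 0 ⟨mod h ⟩
      4S≡0 = [ outer-case , inner-case ]′ b₀-congruence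
        where
        outer-difference : ∀ P S B → B ≡ P + S →
          + 2 * (+ 2 * (B + + 1) * (B + + 1) - + 2) + - + 2 * (+ 2 * P * (B + + 2))
            + - + 1 * (+ 4 * S * (S + + 1)) + - + 1 * (+ 4 * P * S) - + 0 ≡ + 4 * S - + 0
        outer-difference P S _ refl = solve (P ∷ S ∷ [])
        outer-case : + 2 * (B₀ + + 1) * (B₀ + + 1) ≡ + 2 ⟨mod h ⟩ → + 4 * S ≡ + 0 ⟨mod h ⟩
        outer-case outer = mod-by-difference
          (linear-combination (+ 2) (- + 2) (- + 1) (- + 1) (to-zero-mod outer) p-congruence 4S[S+1]≡0 4PS≡0)
          (outer-difference P S B₀ B₀≡P+S)
        inner-difference : ∀ P S B → B ≡ P + S →
          - + 2 * (+ 2 * B * B + + 4 * P) + + 2 * (+ 2 * P * (B + + 2))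
            + + 1 * (+ 4 * S * (S + + 1)) + + 1 * (+ 4 * P * S) - + 0 ≡ + 4 * S - + 0
        inner-difference P S _ refl = solve (P ∷ S ∷ [])
        inner-case : + 2 * B₀ * B₀ + + 4 * P ≡ + 0 ⟨mod h ⟩ → + 4 * S ≡ + 0 ⟨mod h ⟩
        inner-case inner = mod-by-difference
          (linear-combination (- + 2) (+ 2) (+ 1) (+ 1) inner p-congruence 4S[S+1]≡0 4PS≡0)
          (inner-difference P S B₀ B₀≡P+S)

      h≡4s : h ≡ 4 ℕ.* s
      h≡4s = sym (only-multiple-below-double h∣4s ℕ.z<s 4s<2h)
        where
        h∣4s : h ND.∣ 4 ℕ.* s
        h∣4s = subst (h ND.∣_) (cong ℤ.∣_∣ (trans (ℤ.+-identityʳ (+ 4 * S)) (sym (ℤ.pos-* 4 s))))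
                     (∣⇒∣ᵤ (∣-difference 4S≡0))
        split : ∀ p k → 1 ℕ.+ 2 ℕ.* (1 ℕ.+ 2 ℕ.* (1 ℕ.+ (p ℕ.+ k)))
                      ≡ (1 ℕ.+ 4 ℕ.* (1 ℕ.+ k)) ℕ.+ (1 ℕ.+ (1 ℕ.+ 2 ℕ.* (2 ℕ.* p)))
        split = ℕ-Solver.solve-∀
        4s<b : 4 ℕ.* s ℕ.< b
        4s<b = subst (4 ℕ.* s ℕ.<_) (sym (split p k)) (ℕ.m≤m+n (suc (4 ℕ.* s)) (1 ℕ.+ a))
        4s<2h : 4 ℕ.* s ℕ.< 2 ℕ.* h
        4s<2h = subst (4 ℕ.* s ℕ.<_) n≡2h (ℕ.<-trans 4s<b b<n)

      square≡2 : + 2 * (B₀ + + 1) * (B₀ + + 1) ≡ + 2 ⟨mod h ⟩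
      square≡2 = [ (λ outer → outer) , inner-case ]′ b₀-congruence
        where
        difference : ∀ P S B → B ≡ P + S →
                     + 1 * (+ 2 * B * B + + 4 * P) + + 1 * (+ 4 * S) - + 0 ≡ + 2 * (B + + 1) * (B + + 1) - + 2
        difference P S _ refl = solve (P ∷ S ∷ [])
        inner-case : + 2 * B₀ * B₀ + + 4 * P ≡ + 0 ⟨mod h ⟩ → + 2 * (B₀ + + 1) * (B₀ + + 1) ≡ + 2 ⟨mod h ⟩
        inner-case inner = mod-by-difference (linear-combination₂ (+ 1) (+ 1) inner 4S≡0) (difference P S B₀ B₀≡P+S)

      2∣b₀ : 2 ND.∣ b₀
      2∣b₀ = ND.∣m+n∣m⇒∣n (ND.*-cancelˡ-∣ (2 ℕ.* s) 2s*2∣2s*[2+b₀]) (ND.∣-refl {2})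
        where
        difference : ∀ P S B → B ≡ P + S →
                     + 1 * (+ 2 * (B + + 1) * (B + + 1) - + 2) + - + 1 * (+ 2 * P * (B + + 2)) - + 0 ≡ + 2 * S * (+ 2 + B) - + 0
        difference P S _ refl = solve (P ∷ S ∷ [])
        2S[2+B₀]≡0 : + 2 * S * (+ 2 + B₀) ≡ + 0 ⟨mod h ⟩
        2S[2+B₀]≡0 = mod-by-difference (linear-combination₂ (+ 1) (- + 1) (to-zero-mod square≡2) p-congruence)
                                       (difference P S B₀ B₀≡P+S)
        to-ℕ : ℤ.∣ + 2 * S * (+ 2 + B₀) - + 0 ∣ ≡ 2 ℕ.* s ℕ.* (2 ℕ.+ b₀)
        to-ℕ = cong ℤ.∣_∣ (trans (ℤ.+-identityʳ _)
                 (sym (trans (ℤ.pos-* (2 ℕ.* s) (2 ℕ.+ b₀)) (cong₂ _*_ (ℤ.pos-* 2 s) (ℤ.pos-+ 2 b₀)))))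
        h≡2s*2 : h ≡ 2 ℕ.* s ℕ.* 2
        h≡2s*2 = trans h≡4s (reorder s)
          where
          reorder : ∀ s → 4 ℕ.* s ≡ 2 ℕ.* s ℕ.* 2
          reorder = ℕ-Solver.solve-∀
        2s*2∣2s*[2+b₀] : 2 ℕ.* s ℕ.* 2 ND.∣ 2 ℕ.* s ℕ.* (2 ℕ.+ b₀)
        2s*2∣2s*[2+b₀] = subst₂ ND._∣_ h≡2s*2 to-ℕ (∣⇒∣ᵤ (∣-difference 2S[2+B₀]≡0))

      4[b₀+1]²≡4 : (+ (4 ℕ.* (b₀ ℕ.+ 1) ℕ.^ 2)) ≡ (+ 4) [mod n ]
      4[b₀+1]²≡4 = ⟨mod⟩⇒[mod] in-ℤ
        where
        difference : ∀ Q B → Q ≡ + 4 * ((B + + 1) * ((B + + 1) * + 1)) →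
                     + 2 * (+ 2 * (B + + 1) * (B + + 1)) - + 2 * + 2 ≡ Q - + 4
        difference _ B refl = solve (B ∷ [])
        in-ℤ : + (4 ℕ.* (b₀ ℕ.+ 1) ℕ.^ 2) ≡ + 4 ⟨mod n ⟩
        in-ℤ = mod-by-difference (double square≡2) (difference (+ (4 ℕ.* (b₀ ℕ.+ 1) ℕ.^ 2)) B₀ (pos-4*square (b₀ ℕ.+ 1)))

      n≡8s : n ≡ 8 ℕ.* s
      n≡8s = trans n≡2h (trans (cong (2 ℕ.*_) h≡4s) (sym (ℕ.*-assoc 2 4 s)))

      a≡b-n/2-2 : + a ≡ + b ℤ.- + (n ℕ./ 2) ℤ.- + 2
      a≡b-n/2-2 = difference (+ a) (+ b) (+ (n ℕ./ 2)) P S B₀ +a +b +n/2 B₀≡P+S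
        where
        n/2≡4s : n ℕ./ 2 ≡ 4 ℕ.* s
        n/2≡4s = trans (cong (ℕ._/ 2) (trans n≡2h (ℕ.*-comm 2 h))) (trans (ℕ.m*n/n≡m h 2) h≡4s)
        +n/2 : + (n ℕ./ 2) ≡ + 4 * S
        +n/2 = trans (cong +_ n/2≡4s) (ℤ.pos-* 4 s)
        difference : ∀ A B′ H P S B → A ≡ + 1 + + 2 * (+ 2 * P) → B′ ≡ + 1 + + 2 * (+ 1 + + 2 * B) →
                     H ≡ + 4 * S → B ≡ P + S → A ≡ B′ - H - + 2
        difference _ _ _ P S _ refl refl refl refl = solve (P ∷ S ∷ [])

      4b<3n+4 : 4 ℕ.* b ℕ.< 3 ℕ.* n ℕ.+ 4
      4b<3n+4 = subst₂ ℕ._<_ (sym 4b≡) (three-halves n) (ℕ.+-monoˡ-< (n ℕ.+ 4) (ℕ.*-monoʳ-< 2 b+a<n))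
        where
        rearrange : ∀ p k → 4 ℕ.* (1 ℕ.+ 2 ℕ.* (1 ℕ.+ 2 ℕ.* (1 ℕ.+ (p ℕ.+ k))))
                          ≡ 2 ℕ.* ((1 ℕ.+ 2 ℕ.* (1 ℕ.+ 2 ℕ.* (1 ℕ.+ (p ℕ.+ k)))) ℕ.+ (1 ℕ.+ 2 ℕ.* (2 ℕ.* p)))
                            ℕ.+ (8 ℕ.* (1 ℕ.+ k) ℕ.+ 4)
        rearrange = ℕ-Solver.solve-∀
        4b≡ : 4 ℕ.* b ≡ 2 ℕ.* (b ℕ.+ a) ℕ.+ (n ℕ.+ 4)
        4b≡ = trans (rearrange p k) (cong (λ m → 2 ℕ.* (b ℕ.+ a) ℕ.+ (m ℕ.+ 4)) (sym n≡8s))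
        three-halves : ∀ n → 2 ℕ.* n ℕ.+ (n ℕ.+ 4) ≡ 3 ℕ.* n ℕ.+ 4
        three-halves = ℕ-Solver.solve-∀

      b≡4b₀+3 : b ≡ 4 ℕ.* b₀ ℕ.+ 3
      b≡4b₀+3 = odd-odd b₀
        where
        odd-odd : ∀ x → 1 ℕ.+ 2 ℕ.* (1 ℕ.+ 2 ℕ.* x) ≡ 4 ℕ.* x ℕ.+ 3
        odd-odd = ℕ-Solver.solve-∀

      conclusion : ArithmeticCondition n a b
      conclusion = ND.divides s (trans n≡8s (ℕ.*-comm 8 s)) ,
                   b₀ , (b≡4b₀+3 , 4b<3n+4 , ℕ.z<s , 2∣b₀ , 4[b₀+1]²≡4) , a≡b-n/2-2

  p<b₀ : ∀ {p b₀} → 1 ℕ.+ 2 ℕ.* (2 ℕ.* p) ℕ.< (1 ℕ.+ 2 ℕ.* (1 ℕ.+ 2 ℕ.* b₀)) ℕ.∸ 2 → p ℕ.< b₀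
  p<b₀ {p} {b₀} a<b-2 = ℕ.*-cancelˡ-< 4 p b₀ (ℕ.+-cancelˡ-< 1 (4 ℕ.* p) (4 ℕ.* b₀) (subst₂ ℕ._<_ (a≡ p) b-2≡ a<b-2))
    where
    a≡ : ∀ p → 1 ℕ.+ 2 ℕ.* (2 ℕ.* p) ≡ 1 ℕ.+ 4 ℕ.* p
    a≡ = ℕ-Solver.solve-∀
    b≡ : ∀ b₀ → 1 ℕ.+ 2 ℕ.* (1 ℕ.+ 2 ℕ.* b₀) ≡ 2 ℕ.+ (1 ℕ.+ 4 ℕ.* b₀)
    b≡ = ℕ-Solver.solve-∀
    b-2≡ : (1 ℕ.+ 2 ℕ.* (1 ℕ.+ 2 ℕ.* b₀)) ℕ.∸ 2 ≡ 1 ℕ.+ 4 ℕ.* b₀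
    b-2≡ = trans (cong (ℕ._∸ 2) (b≡ b₀)) (ℕ.m+n∸m≡n 2 (1 ℕ.+ 4 ℕ.* b₀))

  b+a<n : ∀ a b → + b - + 2 ℤ.< + n - + a - + 2 → b ℕ.+ a ℕ.< n
  b+a<n a b ineq = ℤ.drop‿+<+ (subst₂ ℤ._<_ (cancel₁ (+ b) (+ a)) (cancel₂ (+ n) (+ a)) (ℤ.+-monoˡ-< (+ a + + 2) ineq))
    where
    cancel₁ : ∀ B A → B - + 2 + (A + + 2) ≡ B + A
    cancel₁ = solve-∀
    cancel₂ : ∀ N A → N - A - + 2 + (A + + 2) ≡ N
    cancel₂ = solve-∀

  arithmetic-condition : ∀ {a b α₀ β₀} → a ≡ 1 ℕ.+ 2 ℕ.* α₀ → b ≡ 1 ℕ.+ 2 ℕ.* β₀ → NecessaryCongruences h α₀ β₀ →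
                         CondA n a b → SquareCondition n a b → a ℕ.< b ℕ.∸ 2 → b ℕ.< n →
                         + b - + 2 ℤ.< + n - + a - + 2 → ArithmeticCondition n a b
  arithmetic-condition refl refl record { b₀ = b₀ ; p = p ; β₀≡1+2b₀ = refl ; α₀≡2p = refl
                                        ; p-congruence = p-congruence ; b₀-congruence = b₀-congruence }
                       condA square a<b-2 b<n ineq with ℕ.m≤n⇒∃[o]m+o≡n {suc p} {b₀} (p<b₀ {p} {b₀} a<b-2)
  ... | k , refl = Derivation.conclusion p k condA square p-congruence b₀-congruence b<n (b+a<n (Derivation.a p k) (Derivation.b p k) ineq)

module Sufficiency (n h m : ℕ) .{{_ : NonZero n}} (n≡2h : n ≡ 2 ℕ.* h) (h≡2m : h ≡ 2 ℕ.* m) (A M : ℤ)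
                   (M²≡1 : M ℤ.* M ℤ.- + 1 ≡ + 0 ⟨mod m ⟩)
                   (A[M+1]≡0 : A ℤ.* (M ℤ.+ + 1) ≡ + 0 ⟨mod m ⟩)
                   (2[M-1-A]≡0 : + 2 ℤ.* (M ℤ.- + 1 ℤ.- A) ≡ + 0 ⟨mod m ⟩) where
  open import Data.Integer using (_+_; _*_; _-_; -_)
  open import Data.Integer.Divisibility.Signed using (_∣_; ∣m∣n⇒∣m+n; ∣n⇒∣m*n)
  open import Data.Integer.Tactic.RingSolver
  open Congruence

  n≡4m : n ≡ 4 ℕ.* m
  n≡4m = trans n≡2h (trans (cong (2 ℕ.*_) h≡2m) (sym (ℕ.*-assoc 2 2 m)))

  module C = ColourMaps n h n≡2h (+ 2 * A) (+ 2 * M - + 1)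
  open C using (neighbour; neighbourᴸ; Swaps)
  open Residues n using (residue)
  module L₄ = Lifting n 4 m n≡4m
  open L₄ using (u; v; u≈; v≈)

  by-relations : ∀ {x y} c₁ c₂ c₃ → x - y ≡ c₁ * (M * M - + 1) + c₂ * (A * (M + + 1)) + c₃ * (+ 2 * (M - + 1 - A)) →
                 x ≡ y ⟨mod m ⟩
  by-relations c₁ c₂ c₃ eq = mod⟨ ∣-resp combination eq ⟩
    where
    combination : + m ∣ c₁ * (M * M - + 1) + c₂ * (A * (M + + 1)) + c₃ * (+ 2 * (M - + 1 - A))
    combination = ∣m∣n⇒∣m+n (∣m∣n⇒∣m+n (∣n⇒∣m*n c₁ (zero-mod⇒∣ M²≡1)) (∣n⇒∣m*n c₂ (zero-mod⇒∣ A[M+1]≡0)))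
                            (∣n⇒∣m*n c₃ (zero-mod⇒∣ 2[M-1-A]≡0))

  neighbour₄ : Colour → L₄.Label → L₄.Label
  neighbour₄ red   (u K r)  = v K r
  neighbour₄ red   (v K r)  = u K r
  neighbour₄ blue  (u K 0F) = u K 1F
  neighbour₄ blue  (u K 1F) = u K 0F
  neighbour₄ blue  (u K 2F) = u K 3F
  neighbour₄ blue  (u K 3F) = u K 2F
  neighbour₄ blue  (v K 0F) = v (K + A) 1F
  neighbour₄ blue  (v K 1F) = v (K - A) 0F
  neighbour₄ blue  (v K 2F) = v (K + A) 3F
  neighbour₄ blue  (v K 3F) = v (K - A) 2F
  neighbour₄ green (u K 0F) = u (K - + 1) 3F
  neighbour₄ green (u K 1F) = u K 2F
  neighbour₄ green (u K 2F) = u K 1F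
  neighbour₄ green (u K 3F) = u (K + + 1) 0F
  neighbour₄ green (v K 0F) = v (K + (M - + 1)) 3F
  neighbour₄ green (v K 1F) = v (K - M) 2F
  neighbour₄ green (v K 2F) = v (K + M) 1F
  neighbour₄ green (v K 3F) = v (K - (M - + 1)) 0F

  -- With a = 4A+1 and b = 4M-1 (in the main theorem M = b₀+1 and A = b₀-s).
  σᴸ : L₄.Label → L₄.Label
  σᴸ (u K 0F) = u (K * M) 0F
  σᴸ (u K 1F) = v (K * M) 0F
  σᴸ (u K 2F) = v (K * M + (M - + 1)) 3F
  σᴸ (u K 3F) = u (K * M + (M - + 1)) 3F
  σᴸ (v K 0F) = u (K * M) 1F
  σᴸ (v K 1F) = v (K * M + A) 1F
  σᴸ (v K 2F) = v (K * M + (M - + 1 - A)) 2F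
  σᴸ (v K 3F) = u (K * M + (M - + 1)) 2F

  σᴸ-red : ∀ ℓ → σᴸ (neighbour₄ red ℓ) L₄.≈ neighbour₄ blue (σᴸ ℓ)
  σᴸ-red (u K 0F) = u≈ mod-refl
  σᴸ-red (u K 1F) = v≈ mod-refl
  σᴸ-red (u K 2F) = v≈ (≡⇒≡⟨mod⟩ (solve (K ∷ M ∷ A ∷ [])))
  σᴸ-red (u K 3F) = u≈ mod-refl
  σᴸ-red (v K 0F) = u≈ mod-refl
  σᴸ-red (v K 1F) = v≈ (≡⇒≡⟨mod⟩ (solve (K ∷ M ∷ A ∷ [])))
  σᴸ-red (v K 2F) = v≈ (≡⇒≡⟨mod⟩ (solve (K ∷ M ∷ A ∷ [])))
  σᴸ-red (v K 3F) = u≈ mod-refl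

  σᴸ-green : ∀ ℓ → σᴸ (neighbour₄ green ℓ) L₄.≈ neighbour₄ green (σᴸ ℓ)
  σᴸ-green (u K 0F) = u≈ (≡⇒≡⟨mod⟩ (solve (K ∷ M ∷ [])))
  σᴸ-green (u K 1F) = v≈ (≡⇒≡⟨mod⟩ (solve (K ∷ M ∷ [])))
  σᴸ-green (u K 2F) = v≈ (≡⇒≡⟨mod⟩ (solve (K ∷ M ∷ [])))
  σᴸ-green (u K 3F) = u≈ (≡⇒≡⟨mod⟩ (solve (K ∷ M ∷ [])))
  σᴸ-green (v K 0F) = u≈ (by-relations (+ 1) (+ 0) (+ 0) (solve (K ∷ M ∷ A ∷ [])))
  σᴸ-green (v K 1F) = v≈ (by-relations (- + 1) (+ 0) (+ 1) (solve (K ∷ M ∷ A ∷ [])))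
  σᴸ-green (v K 2F) = v≈ (by-relations (+ 1) (+ 0) (- + 1) (solve (K ∷ M ∷ A ∷ [])))
  σᴸ-green (v K 3F) = u≈ (by-relations (- + 1) (+ 0) (+ 0) (solve (K ∷ M ∷ A ∷ [])))

  σᴸ-involutive : ∀ ℓ → σᴸ (σᴸ ℓ) L₄.≈ ℓ
  σᴸ-involutive (u K 0F) = u≈ (by-relations K (+ 0) (+ 0) (solve (K ∷ M ∷ A ∷ [])))
  σᴸ-involutive (u K 1F) = u≈ (by-relations K (+ 0) (+ 0) (solve (K ∷ M ∷ A ∷ [])))
  σᴸ-involutive (u K 2F) = u≈ (by-relations (K + + 1) (+ 0) (+ 0) (solve (K ∷ M ∷ A ∷ [])))
  σᴸ-involutive (u K 3F) = u≈ (by-relations (K + + 1) (+ 0) (+ 0) (solve (K ∷ M ∷ A ∷ [])))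
  σᴸ-involutive (v K 0F) = v≈ (by-relations K (+ 0) (+ 0) (solve (K ∷ M ∷ A ∷ [])))
  σᴸ-involutive (v K 1F) = v≈ (by-relations K (+ 1) (+ 0) (solve (K ∷ M ∷ A ∷ [])))
  σᴸ-involutive (v K 2F) = v≈ (by-relations (K + + 1) (- + 1) (+ 0) (solve (K ∷ M ∷ A ∷ [])))
  σᴸ-involutive (v K 3F) = v≈ (by-relations (K + + 1) (+ 0) (+ 0) (solve (K ∷ M ∷ A ∷ [])))

  σᴸ-cong : L₄.Congruent σᴸ
  σᴸ-cong (u≈ {r = 0F} K≡K′) = u≈ (*-congʳ-mod M K≡K′)
  σᴸ-cong (u≈ {r = 1F} K≡K′) = v≈ (*-congʳ-mod M K≡K′)
  σᴸ-cong (u≈ {r = 2F} K≡K′) = v≈ (+-congʳ-mod (M - + 1) (*-congʳ-mod M K≡K′))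
  σᴸ-cong (u≈ {r = 3F} K≡K′) = u≈ (+-congʳ-mod (M - + 1) (*-congʳ-mod M K≡K′))
  σᴸ-cong (v≈ {r = 0F} K≡K′) = u≈ (*-congʳ-mod M K≡K′)
  σᴸ-cong (v≈ {r = 1F} K≡K′) = v≈ (+-congʳ-mod A (*-congʳ-mod M K≡K′))
  σᴸ-cong (v≈ {r = 2F} K≡K′) = v≈ (+-congʳ-mod (M - + 1 - A) (*-congʳ-mod M K≡K′))
  σᴸ-cong (v≈ {r = 3F} K≡K′) = u≈ (+-congʳ-mod (M - + 1) (*-congʳ-mod M K≡K′))

  halve-label : L₄.Label → C.Label
  halve-label (u K 0F) = C.u (+ 2 * K) 0F
  halve-label (u K 1F) = C.u (+ 2 * K) 1F
  halve-label (u K 2F) = C.u (+ 2 * K + + 1) 0F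
  halve-label (u K 3F) = C.u (+ 2 * K + + 1) 1F
  halve-label (v K 0F) = C.v (+ 2 * K) 0F
  halve-label (v K 1F) = C.v (+ 2 * K) 1F
  halve-label (v K 2F) = C.v (+ 2 * K + + 1) 0F
  halve-label (v K 3F) = C.v (+ 2 * K + + 1) 1F

  π₄≡π∘halve-label : ∀ ℓ → L₄.π ℓ ≡ C.π (halve-label ℓ)
  π₄≡π∘halve-label (u K 0F) = cong (λ z → Vtx.u (residue z)) {x = + 4 * K + + 0} {y = + 2 * (+ 2 * K) + + 0} (solve (K ∷ []))
  π₄≡π∘halve-label (u K 1F) = cong (λ z → Vtx.u (residue z)) {x = + 4 * K + + 1} {y = + 2 * (+ 2 * K) + + 1} (solve (K ∷ []))
  π₄≡π∘halve-label (u K 2F) = cong (λ z → Vtx.u (residue z)) {x = + 4 * K + + 2} {y = + 2 * (+ 2 * K + + 1) + + 0} (solve (K ∷ []))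
  π₄≡π∘halve-label (u K 3F) = cong (λ z → Vtx.u (residue z)) {x = + 4 * K + + 3} {y = + 2 * (+ 2 * K + + 1) + + 1} (solve (K ∷ []))
  π₄≡π∘halve-label (v K 0F) = cong (λ z → Vtx.v (residue z)) {x = + 4 * K + + 0} {y = + 2 * (+ 2 * K) + + 0} (solve (K ∷ []))
  π₄≡π∘halve-label (v K 1F) = cong (λ z → Vtx.v (residue z)) {x = + 4 * K + + 1} {y = + 2 * (+ 2 * K) + + 1} (solve (K ∷ []))
  π₄≡π∘halve-label (v K 2F) = cong (λ z → Vtx.v (residue z)) {x = + 4 * K + + 2} {y = + 2 * (+ 2 * K + + 1) + + 0} (solve (K ∷ []))
  π₄≡π∘halve-label (v K 3F) = cong (λ z → Vtx.v (residue z)) {x = + 4 * K + + 3} {y = + 2 * (+ 2 * K + + 1) + + 1} (solve (K ∷ []))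

  neighbourᴸ∘halve-label : ∀ c ℓ → neighbourᴸ c (halve-label ℓ) C.≈ halve-label (neighbour₄ c ℓ)
  neighbourᴸ∘halve-label red   (u K 0F) = C.v≈ (≡⇒≡⟨mod⟩ (solve (K ∷ M ∷ A ∷ [])))
  neighbourᴸ∘halve-label red   (u K 1F) = C.v≈ (≡⇒≡⟨mod⟩ (solve (K ∷ M ∷ A ∷ [])))
  neighbourᴸ∘halve-label red   (u K 2F) = C.v≈ (≡⇒≡⟨mod⟩ (solve (K ∷ M ∷ A ∷ [])))
  neighbourᴸ∘halve-label red   (u K 3F) = C.v≈ (≡⇒≡⟨mod⟩ (solve (K ∷ M ∷ A ∷ [])))
  neighbourᴸ∘halve-label red   (v K 0F) = C.u≈ (≡⇒≡⟨mod⟩ (solve (K ∷ M ∷ A ∷ [])))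
  neighbourᴸ∘halve-label red   (v K 1F) = C.u≈ (≡⇒≡⟨mod⟩ (solve (K ∷ M ∷ A ∷ [])))
  neighbourᴸ∘halve-label red   (v K 2F) = C.u≈ (≡⇒≡⟨mod⟩ (solve (K ∷ M ∷ A ∷ [])))
  neighbourᴸ∘halve-label red   (v K 3F) = C.u≈ (≡⇒≡⟨mod⟩ (solve (K ∷ M ∷ A ∷ [])))
  neighbourᴸ∘halve-label blue  (u K 0F) = C.u≈ (≡⇒≡⟨mod⟩ (solve (K ∷ M ∷ A ∷ [])))
  neighbourᴸ∘halve-label blue  (u K 1F) = C.u≈ (≡⇒≡⟨mod⟩ (solve (K ∷ M ∷ A ∷ [])))
  neighbourᴸ∘halve-label blue  (u K 2F) = C.u≈ (≡⇒≡⟨mod⟩ (solve (K ∷ M ∷ A ∷ [])))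
  neighbourᴸ∘halve-label blue  (u K 3F) = C.u≈ (≡⇒≡⟨mod⟩ (solve (K ∷ M ∷ A ∷ [])))
  neighbourᴸ∘halve-label blue  (v K 0F) = C.v≈ (≡⇒≡⟨mod⟩ (solve (K ∷ M ∷ A ∷ [])))
  neighbourᴸ∘halve-label blue  (v K 1F) = C.v≈ (≡⇒≡⟨mod⟩ (solve (K ∷ M ∷ A ∷ [])))
  neighbourᴸ∘halve-label blue  (v K 2F) = C.v≈ (≡⇒≡⟨mod⟩ (solve (K ∷ M ∷ A ∷ [])))
  neighbourᴸ∘halve-label blue  (v K 3F) = C.v≈ (≡⇒≡⟨mod⟩ (solve (K ∷ M ∷ A ∷ [])))
  neighbourᴸ∘halve-label green (u K 0F) = C.u≈ (≡⇒≡⟨mod⟩ (solve (K ∷ M ∷ A ∷ [])))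
  neighbourᴸ∘halve-label green (u K 1F) = C.u≈ (≡⇒≡⟨mod⟩ (solve (K ∷ M ∷ A ∷ [])))
  neighbourᴸ∘halve-label green (u K 2F) = C.u≈ (≡⇒≡⟨mod⟩ (solve (K ∷ M ∷ A ∷ [])))
  neighbourᴸ∘halve-label green (u K 3F) = C.u≈ (≡⇒≡⟨mod⟩ (solve (K ∷ M ∷ A ∷ [])))
  neighbourᴸ∘halve-label green (v K 0F) = C.v≈ (≡⇒≡⟨mod⟩ (solve (K ∷ M ∷ A ∷ [])))
  neighbourᴸ∘halve-label green (v K 1F) = C.v≈ (≡⇒≡⟨mod⟩ (solve (K ∷ M ∷ A ∷ [])))
  neighbourᴸ∘halve-label green (v K 2F) = C.v≈ (≡⇒≡⟨mod⟩ (solve (K ∷ M ∷ A ∷ [])))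
  neighbourᴸ∘halve-label green (v K 3F) = C.v≈ (≡⇒≡⟨mod⟩ (solve (K ∷ M ∷ A ∷ [])))

  neighbour-π₄ : ∀ c ℓ → neighbour c (L₄.π ℓ) ≡ L₄.π (neighbour₄ c ℓ)
  neighbour-π₄ c ℓ = begin
    neighbour c (L₄.π ℓ)                 ≡⟨ cong (neighbour c) (π₄≡π∘halve-label ℓ) ⟩
    neighbour c (C.π (halve-label ℓ))    ≡⟨ C.neighbour-π c (halve-label ℓ) ⟩
    C.π (neighbourᴸ c (halve-label ℓ))   ≡⟨ C.π-cong (neighbourᴸ∘halve-label c ℓ) ⟩
    C.π (halve-label (neighbour₄ c ℓ))   ≡⟨ π₄≡π∘halve-label (neighbour₄ c ℓ) ⟨
    L₄.π (neighbour₄ c ℓ)                ∎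
    where open ≡-Reasoning

  σ : Vtx n → Vtx n
  σ = L₄.descend σᴸ

  σ-π : ∀ ℓ → σ (L₄.π ℓ) ≡ L₄.π (σᴸ ℓ)
  σ-π = L₄.descend-π σᴸ-cong

  by-labels : ∀ {P : Vtx n → Set} → (∀ ℓ → P (L₄.π ℓ)) → ∀ x → P x
  by-labels {P} P-π x = subst P (L₄.π-lift x) (P-π (L₄.lift x))

  σ-involutive : ∀ x → σ (σ x) ≡ x
  σ-involutive = by-labels λ ℓ → trans (cong σ (σ-π ℓ)) (trans (σ-π (σᴸ ℓ)) (L₄.π-cong (σᴸ-involutive ℓ)))

  σ-commutes : ∀ c → (∀ ℓ → σᴸ (neighbour₄ c ℓ) L₄.≈ neighbour₄ (swap c) (σᴸ ℓ)) →
               ∀ x → σ (neighbour c x) ≡ neighbour (swap c) (σ x)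
  σ-commutes c σᴸ-commutes = by-labels λ ℓ → begin
    σ (neighbour c (L₄.π ℓ))                  ≡⟨ cong σ (neighbour-π₄ c ℓ) ⟩
    σ (L₄.π (neighbour₄ c ℓ))                 ≡⟨ σ-π (neighbour₄ c ℓ) ⟩
    L₄.π (σᴸ (neighbour₄ c ℓ))                ≡⟨ L₄.π-cong (σᴸ-commutes ℓ) ⟩
    L₄.π (neighbour₄ (swap c) (σᴸ ℓ))         ≡⟨ neighbour-π₄ (swap c) (σᴸ ℓ) ⟨
    neighbour (swap c) (L₄.π (σᴸ ℓ))          ≡⟨ cong (neighbour (swap c)) (σ-π ℓ) ⟨
    neighbour (swap c) (σ (L₄.π ℓ))           ∎
    where open ≡-Reasoning

  σ-swaps : Swaps σ
  σ-swaps red   = σ-commutes red σᴸ-red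
  σ-swaps green = σ-commutes green σᴸ-green
  σ-swaps blue x = begin
    σ (neighbour blue x)            ≡⟨ cong (σ ∘ neighbour blue) (σ-involutive x) ⟨
    σ (neighbour blue (σ (σ x)))    ≡⟨ cong σ (σ-swaps red (σ x)) ⟨
    σ (σ (neighbour red (σ x)))     ≡⟨ σ-involutive (neighbour red (σ x)) ⟩
    neighbour red (σ x)             ∎
    where open ≡-Reasoning

  σ-moves : σ (L₄.π (u (+ 0) 1F)) ≢ L₄.π (u (+ 0) 1F)
  σ-moves eq = v≢u (trans (sym (σ-π (u (+ 0) 1F))) eq)
    where
    v≢u : ∀ {i j : Fin n} → Vtx.v i ≢ Vtx.u j
    v≢u ()

ColourSwappingInvolution : (n a b : ℕ) .{{_ : NonZero n}} → Set
ColourSwappingInvolution n a b = ∃[ σ ] (IsAutomorphism (Edge n a b) σ × HasOrder2 σ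
                                         × MapsOnto σ (B n a b) (R n a b) × MapsOnto σ (R n a b) (B n a b))

odd⇒1+2* : ∀ {m} → ¬ (2 ND.∣ m) → ∃[ q ] m ≡ 1 ℕ.+ 2 ℕ.* q
odd⇒1+2* {m} m-odd with even-or-odd m
... | inj₁ (q , m≡2q) = contradiction (ND.divides q (trans m≡2q (ℕ.*-comm 2 q))) m-odd
... | inj₂ m≡1+2q = m≡1+2q

condA-of-blue-edge : ∀ {n a b} .{{_ : NonZero n}} → a ℕ.< b → b ℕ.< n → ¬ (2 ND.∣ a) →
                     B n a b (v (0 ℕ.mod n)) (v (a ℕ.mod n)) → CondA n a b
condA-of-blue-edge _ _ _ (inj₁ (inj₁ (_ , _ , () , _)))
condA-of-blue-edge _ _ _ (inj₁ (inj₂ (_ , _ , () , _)))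
condA-of-blue-edge _ _ _ (inj₂ (inj₁ (condA , _))) = condA
condA-of-blue-edge {n} {a} {b} a<b b<n a-odd (inj₂ (inj₂ (_ , inj₁ (i , _ , v0≡vi , va≡vi+b)))) =
  contradiction a≡b (ℕ.<⇒≢ a<b)
  where
  i≡0 : toℕ i ≡ 0
  i≡0 = trans (cong toℕ (sym (v-injective v0≡vi))) (toℕ-mod (ℕ.≤-<-trans ℕ.z≤n b<n))
  a≡b : a ≡ b
  a≡b = begin
    a                          ≡⟨ toℕ-mod (ℕ.<-trans a<b b<n) ⟨
    toℕ (a ℕ.mod n)            ≡⟨ cong toℕ (v-injective va≡vi+b) ⟩
    toℕ (i ⊕ b)                ≡⟨ Fin.toℕ-fromℕ< _ ⟩
    (toℕ i ℕ.+ b) ℕ.% n        ≡⟨ cong (λ t → (t ℕ.+ b) ℕ.% n) i≡0 ⟩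
    b ℕ.% n                    ≡⟨ ℕ.m<n⇒m%n≡m b<n ⟩
    b                          ∎
    where open ≡-Reasoning
condA-of-blue-edge {n} {a} a<b b<n a-odd (inj₂ (inj₂ (_ , inj₂ (i , i-even , va≡vi , _)))) =
  contradiction (subst (2 ND.∣_) (trans (cong toℕ (sym (v-injective va≡vi))) (toℕ-mod (ℕ.<-trans a<b b<n))) i-even) a-odd

module Proposition (n a b : ℕ) .{{_ : NonZero n}}
                   (2∣n : 2 ND.∣ n) (4≤n : 4 ℕ.≤ n) (a-odd : ¬ (2 ND.∣ a)) (b-odd : ¬ (2 ND.∣ b))
                   (a<b : a ℕ.< b) (b<n : b ℕ.< n) (square : SquareCondition n a b) (a<b-2 : a ℕ.< b ℕ.∸ 2)
                   (ineq : + b ℤ.- + 2 ℤ.< + n ℤ.- + a ℤ.- + 2)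
                   (blue-edge : B n a b (v (0 ℕ.mod n)) (v (a ℕ.mod n))) where
  open import Data.Integer using (_+_; _*_; _-_; -_)
  open import Data.Integer.Divisibility.Signed using (divides; ∣⇒∣ᵤ; ∣-refl)
  open import Data.Integer.Tactic.RingSolver
  import Data.Nat.Tactic.RingSolver as ℕ-Solver
  open Congruence

  h : ℕ
  h = ND.quotient 2∣n

  n≡2h : n ≡ 2 ℕ.* h
  n≡2h = trans (ND.m∣n⇒n≡quotient*m 2∣n) (ℕ.*-comm h 2)

  condA : CondA n a b
  condA = condA-of-blue-edge a<b b<n a-odd blue-edge

  α₀ β₀ : ℕ
  α₀ = proj₁ (odd⇒1+2* a-odd)
  β₀ = proj₁ (odd⇒1+2* b-odd)

  a≡1+2α₀ : a ≡ 1 ℕ.+ 2 ℕ.* α₀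
  a≡1+2α₀ = proj₂ (odd⇒1+2* a-odd)

  b≡1+2β₀ : b ≡ 1 ℕ.+ 2 ℕ.* β₀
  b≡1+2β₀ = proj₂ (odd⇒1+2* b-odd)

  α₀<β₀ : α₀ ℕ.< β₀
  α₀<β₀ = ℕ.*-cancelˡ-< 2 α₀ β₀ (ℕ.+-cancelˡ-< 1 (2 ℕ.* α₀) (2 ℕ.* β₀) (subst₂ ℕ._<_ a≡1+2α₀ b≡1+2β₀ a<b))

  β₀<h : β₀ ℕ.< h
  β₀<h = ℕ.*-cancelˡ-< 2 β₀ h (ℕ.<-trans (ℕ.n<1+n (2 ℕ.* β₀)) (subst₂ ℕ._<_ b≡1+2β₀ n≡2h b<n))

  1≢0 : ¬ (+ 1 ≡ + 0 ⟨mod h ⟩)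
  1≢0 1≡0 = ℕ.<⇒≱ (ℕ.s≤s (ℕ.s≤s (ℕ.s≤s ℕ.z≤n)))
                  (subst (4 ℕ.≤_) (trans n≡2h (cong (2 ℕ.*_) (ND.∣1⇒≡1 (∣⇒∣ᵤ (∣-difference 1≡0))))) 4≤n)

  β₀≢α₀ : ¬ (+ β₀ ≡ + α₀ ⟨mod h ⟩)
  β₀≢α₀ β₀≡α₀ = ℕ.<⇒≢ α₀<β₀ (sym (∣m-n∣⇒m≡n β₀<h (ℕ.<-trans α₀<β₀ β₀<h) (∣-difference β₀≡α₀)))

  necessity : ColourSwappingInvolution n a b → ArithmeticCondition n a b
  necessity (σ , automorphism , _ , B↦R , R↦B) =
    Arithmetic.arithmetic-condition n h n≡2h a≡1+2α₀ b≡1+2β₀ (Necessity.necessary-congruences n h α₀ β₀ n≡2h σ σ-swaps)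
                                    condA square a<b-2 b<n ineq
    where
    open Symmetries n a b h n≡2h (+ α₀) (+ β₀) (pos-odd α₀ a≡1+2α₀) (pos-odd β₀ b≡1+2β₀) condA
    σ-swaps : ColourMaps.Swaps n h n≡2h (+ α₀) (+ β₀) σ
    σ-swaps = swaps-of-colour-swapping (ColourMaps.green≢blue n h n≡2h (+ α₀) (+ β₀) 1≢0 β₀≢α₀)
                                       (automorphism , B↦R , R↦B)

  module Construction (s b₀ t : ℕ) (n≡s*8 : n ≡ s ℕ.* 8) (b≡4b₀+3 : b ≡ 4 ℕ.* b₀ ℕ.+ 3) (b₀≡t*2 : b₀ ≡ t ℕ.* 2)
                      (4[b₀+1]²≡4 : (+ (4 ℕ.* (b₀ ℕ.+ 1) ℕ.^ 2)) ≡ (+ 4) [mod n ])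
                      (a≡b-n/2-2 : + a ≡ + b - + (n ℕ./ 2) - + 2) where
    m : ℕ
    m = 2 ℕ.* s

    M A : ℤ
    M = + b₀ + + 1
    A = M - + s - + 1

    n≡4m : n ≡ 4 ℕ.* m
    n≡4m = trans n≡s*8 (regroup s)
      where
      regroup : ∀ s → s ℕ.* 8 ≡ 4 ℕ.* (2 ℕ.* s)
      regroup = ℕ-Solver.solve-∀

    h≡2m : h ≡ 2 ℕ.* m
    h≡2m = ℕ.*-cancelˡ-≡ h (2 ℕ.* m) 2 (trans (sym n≡2h) (trans n≡4m (ℕ.*-assoc 2 2 m)))

    +m : + m ≡ + 2 * + s
    +m = ℤ.pos-* 2 s

    m≡0 : + m ≡ + 0 ⟨mod m ⟩
    m≡0 = ∣⇒zero-mod ∣-refl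

    +b : + b ≡ + 4 * + b₀ + + 3
    +b = trans (cong +_ b≡4b₀+3) (trans (ℤ.pos-+ (4 ℕ.* b₀) 3) (cong (_+ + 3) (ℤ.pos-* 4 b₀)))

    M²-1≡0 : M * M - + 1 ≡ + 0 ⟨mod m ⟩
    M²-1≡0 = to-zero-mod (*-cancelˡ-mod 4 (subst (λ k → + 4 * (M * M) ≡ + 4 * + 1 ⟨mod k ⟩) n≡4m
               (mod-by-difference ([mod]⇒⟨mod⟩ (+ (4 ℕ.* (b₀ ℕ.+ 1) ℕ.^ 2)) (+ 4) 4[b₀+1]²≡4)
                                  (difference _ M (pos-4*square (b₀ ℕ.+ 1))))))
      where
      difference : ∀ Q M → Q ≡ + 4 * (M * (M * + 1)) → Q - + 4 ≡ + 4 * (M * M) - + 4 * + 1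
      difference _ M refl = solve (M ∷ [])

    A[M+1]≡0 : A * (M + + 1) ≡ + 0 ⟨mod m ⟩
    A[M+1]≡0 = mod-by-difference (linear-combination₂ (+ 1) (- (+ t + + 1)) M²-1≡0 m≡0)
                                 (difference (+ b₀) (+ t) (+ s) (+ m) (trans (cong +_ b₀≡t*2) (ℤ.pos-* t 2)) +m)
      where
      difference : ∀ B T S Mm → B ≡ T * + 2 → Mm ≡ + 2 * S →
                   + 1 * ((B + + 1) * (B + + 1) - + 1) + - (T + + 1) * Mm - + 0 ≡ (B + + 1 - S - + 1) * (B + + 1 + + 1) - + 0
      difference _ T S _ refl refl = solve (T ∷ S ∷ [])

    2[M-1-A]≡0 : + 2 * (M - + 1 - A) ≡ + 0 ⟨mod m ⟩
    2[M-1-A]≡0 = mod-by-difference m≡0 (difference (+ b₀) (+ s) (+ m) +m)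
      where
      difference : ∀ B S Mm → Mm ≡ + 2 * S → Mm - + 0 ≡ + 2 * (B + + 1 - + 1 - (B + + 1 - S - + 1)) - + 0
      difference B S _ refl = solve (B ∷ S ∷ [])

    +a : + a ≡ + 1 + + 2 * (+ 2 * A)
    +a = difference (+ a) (+ b) (+ (n ℕ./ 2)) (+ b₀) (+ s) a≡b-n/2-2 +b (trans (cong +_ n/2≡4s) (ℤ.pos-* 4 s))
      where
      n/2≡4s : n ℕ./ 2 ≡ 4 ℕ.* s
      n/2≡4s = trans (cong (ℕ._/ 2) (trans n≡s*8 (regroup s))) (ℕ.m*n/n≡m (4 ℕ.* s) 2)
        where
        regroup : ∀ s → s ℕ.* 8 ≡ 4 ℕ.* s ℕ.* 2
        regroup = ℕ-Solver.solve-∀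
      difference : ∀ A′ B′ H B S → A′ ≡ B′ - H - + 2 → B′ ≡ + 4 * B + + 3 → H ≡ + 4 * S →
                   A′ ≡ + 1 + + 2 * (+ 2 * (B + + 1 - S - + 1))
      difference _ _ _ B S refl refl refl = solve (B ∷ S ∷ [])

    +b′ : + b ≡ + 1 + + 2 * (+ 2 * M - + 1)
    +b′ = difference (+ b) (+ b₀) +b
      where
      difference : ∀ B′ B → B′ ≡ + 4 * B + + 3 → B′ ≡ + 1 + + 2 * (+ 2 * (B + + 1) - + 1)
      difference _ B refl = solve (B ∷ [])

    open Sufficiency n h m n≡2h h≡2m A M M²-1≡0 A[M+1]≡0 2[M-1-A]≡0 using (σ; σ-swaps; σ-involutive; σ-moves)
    open Symmetries n a b h n≡2h (+ 2 * A) (+ 2 * M - + 1) +a +b′ condA using (ColourSwapping; colour-swapping-of-swaps)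

    with-order-two : ColourSwapping σ → ColourSwappingInvolution n a b
    with-order-two (automorphism , B↦R , R↦B) = σ , automorphism , (σ-involutive , _ , σ-moves) , B↦R , R↦B

    swapping-involution : ColourSwappingInvolution n a b
    swapping-involution = with-order-two (colour-swapping-of-swaps σ-swaps σ-involutive)

  sufficiency : ArithmeticCondition n a b → ColourSwappingInvolution n a b
  sufficiency (ND.divides s n≡s*8 , b₀ , (b≡4b₀+3 , _ , _ , ND.divides t b₀≡t*2 , 4[b₀+1]²≡4) , a≡b-n/2-2) =
    Construction.swapping-involution s b₀ t n≡s*8 b≡4b₀+3 b₀≡t*2 4[b₀+1]²≡4 a≡b-n/2-2

open import Data.Nat using (_+_; _*_; _^_; _<_; _≤_)
open import Data.Nat.DivMod using (_/_; _mod_)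

proposition8p3 : (n a b : ℕ) .{{_ : NonZero n}} → Feasible n a b → 1 < a
  → B n a b (v (0 mod n)) (v (a mod n))
  → ((∃[ σ ] (IsAutomorphism (Edge n a b) σ × HasOrder2 σ
        × MapsOnto σ (B n a b) (R n a b) × MapsOnto σ (R n a b) (B n a b)))
     → (8 ND.∣ n × ∃[ b₀ ] (b ≡ 4 * b₀ + 3 × 4 * b < 3 * n + 4 × 0 < b₀ × 2 ND.∣ b₀
          × ((+ (4 * (b₀ + 1) ^ 2)) ≡ (+ 4) [mod n ]))
        × (+ a) ≡ (+ b) ℤ.- (+ (n / 2)) ℤ.- (+ 2)))
   × ((8 ND.∣ n × ∃[ b₀ ] (b ≡ 4 * b₀ + 3 × 4 * b < 3 * n + 4 × 0 < b₀ × 2 ND.∣ b₀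
          × ((+ (4 * (b₀ + 1) ^ 2)) ≡ (+ 4) [mod n ]))
        × (+ a) ≡ (+ b) ℤ.- (+ (n / 2)) ℤ.- (+ 2))
     → ∃[ σ ] (IsAutomorphism (Edge n a b) σ × HasOrder2 σ
        × MapsOnto σ (B n a b) (R n a b) × MapsOnto σ (R n a b) (B n a b)))
proposition8p3 n a b (2∣n , 4≤n , a-odd , b-odd , _ , a<b , b<n , _ , square , _ , _ , a<b-2 , ineq) _ blue-edge =
  necessity , sufficiency
  where open Proposition n a b 2∣n 4≤n a-odd b-odd a<b b<n square a<b-2 ineq blue-edge
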